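{- Let $k$ be an odd positive integer and let $c_2\leq c_3$ be positive integers. Then the petal graph $P_{1,c_2,c_3}$ can be embedded in $K_k^*$ if and only if $c_2\geq3$ and $1+c_2+c_3\leq\binom{k+1}{2}$.
   Context: $K_k^*$ denotes the complete graph $K_k$ on vertices $v_0,\dotsc,v_{k-1}$ with a loop $v_iv_i$ added at every vertex. An embedding of a graph $G$ (simple graph possibly with at most one loop per vertex) in $K_k^*$ is a map $f:V(G)\to V(K_k^*)$ such that each edge $uv$ of $G$ is sent to the edge $f(u)f(v)$ of $K_k^*$ (a loop if $f(u)=f(v)$), and the induced map $E(G)\to E(K_k^*)$ is injective. For positive integers $c_1\leq c_2\leq\dotsb\leq c_m$ ($m\geq2$), the petal graph $P_{c_1,\dotsc,c_m}$ has a central vertex $u_0$ and, for each $i$, vertices $u^i_1,\dotsc,u^i_{c_i-1}$ forming a cycle $u_0u^i_1\dotsb u^i_{c_i-1}u_0$ of length $c_i$ (the $i$-th petal); if $c_i=1$ the $i$-th petal is a loop at $u_0$. Thus $P_{1,c_2,c_3}$ is a loop at $u_0$ together with two cycles of lengths $c_2,c_3$ through $u_0$, and has $1+c_2+c_3$ edges. -}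

module Defs where

open import Data.Nat using (ℕ; zero; suc; pred; _<?_)
open import Data.Fin using (Fin; toℕ; fromℕ<)
open import Data.Maybe using (Maybe; just; nothing)
open import Data.Product using (Σ; _×_; _,_; proj₁; proj₂)
open import Data.Sum using (_⊎_)
open import Data.Vec using (Vec; lookup; _∷_; [])
open import Relation.Nullary using (yes; no)
open import Relation.Binary.PropositionalEquality using (_≡_)

-- Petal graph with m petals of lengths c : Fin m → ℕ (all assumed ≥ 1).
-- Vertices: the centre u₀ (= nothing) and u^i_j for j = 1 … c i - 1
-- (= just (i , j-1)).
PVertex : {m : ℕ} → (Fin m → ℕ) → Set
PVertex {m} c = Maybe (Σ (Fin m) λ i → Fin (pred (c i)))

-- p-th vertex along the cycle of petal i: position 0 and position c i are u₀.
node : {m : ℕ} (c : Fin m → ℕ) (i : Fin m) → ℕ → PVertex c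
node c i zero = nothing
node c i (suc p) with p <? pred (c i)
... | yes h = just (i , fromℕ< h)
... | no _  = nothing

-- Edges (counted with multiplicity): petal i has c i edges, the j-th joining
-- positions j and j+1 of its cycle.  For c i = 1 this is a loop at u₀.
PEdge : {m : ℕ} → (Fin m → ℕ) → Set
PEdge {m} c = Σ (Fin m) λ i → Fin (c i)

ends : {m : ℕ} (c : Fin m → ℕ) → PEdge c → PVertex c × PVertex c
ends c (i , j) = node c i (toℕ j) , node c i (suc (toℕ j))

-- Edges of K_k^* are unordered pairs {a,b} of vertices in Fin k (a ≡ b: loop).
SameEdge : {k : ℕ} → Fin k × Fin k → Fin k × Fin k → Set
SameEdge (a , b) (a' , b') = (a ≡ a' × b ≡ b') ⊎ (a ≡ b' × b ≡ a')

IsEmbedding : {m : ℕ} (c : Fin m → ℕ) (k : ℕ) → (PVertex c → Fin k) → Set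
IsEmbedding c k f =
  ∀ (e e' : PEdge c) →
    SameEdge (f (proj₁ (ends c e)) , f (proj₂ (ends c e)))
             (f (proj₁ (ends c e')) , f (proj₂ (ends c e'))) →
    e ≡ e'

EmbedsIn : {m : ℕ} (c : Fin m → ℕ) (k : ℕ) → Set
EmbedsIn c k = Σ (PVertex c → Fin k) (IsEmbedding c k)

petal1 : ℕ → ℕ → Fin 3 → ℕ
petal1 c₂ c₃ = lookup (1 ∷ c₂ ∷ c₃ ∷ [])

-- Put the centre u₀ at vertex 0 and the loop petal on the loop there; the other two petals
-- become edge-disjoint closed walks through 0 that avoid that loop.  Conversely, an embedding
-- sends the 1 + c₂ + c₃ edges injectively to the (k+1) C 2 edges of K_k^*.
-- Sufficiency is by induction from k to k + 2 (k odd).  The 2k + 3 edges at the new vertices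
-- k and k + 1 are traversed by one closed walk through 0, and shortening it gives detours of
-- every length up to 2k + 3 except 1, 2 and those ≡ 2 (mod 4).  So an excess e of 1 + c₂ + c₃
-- over (k+1) C 2 is absorbed by a detour of length in [e, e + 2] spliced into the longer
-- petal, the shortened pair being realised in K_k^* by induction.  This needs the shorter
-- petal to be small compared with (k+1) C 2, which holds from k = 7 on; k = 5 and k = 7 are
-- settled by explicit walks checked by evaluation.

module Submission where

open import Defs
open import Data.Bool using (Bool; true; false; if_then_else_; _∧_)
open import Data.Empty using (⊥-elim)
open import Data.Fin as Fin using (Fin; toℕ; fromℕ<; splitAt; join; _↑ˡ_; _↑ʳ_)
open import Data.Fin.Patterns using (0F; 1F; 2F)
import Data.Fin.Properties as Finₚ
open import Data.List using (List; []; _∷_; length; _++_; tabulate)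
open import Data.List.Properties using (tabulate-cong; length-++)
open import Data.List.Membership.Propositional using (_∈_; _∉_)
open import Data.List.Membership.Propositional.Properties using (∈-tabulate⁺; ∈-++⁻)
open import Data.List.Relation.Binary.Disjoint.Propositional using (Disjoint)
open import Data.List.Relation.Unary.All as All using (All; []; _∷_; all?)
import Data.List.Relation.Unary.All.Properties as Allₚ
open import Data.List.Relation.Unary.Any using (here)
open import Data.List.Relation.Unary.Unique.Propositional using (Unique; []; _∷_)
import Data.List.Relation.Unary.Unique.Propositional.Properties as Uniqueₚ
open import Data.Maybe using (just; nothing)
open import Data.Nat
  using (ℕ; zero; suc; pred; _+_; _*_; _≤_; _<_; _⊓_; _⊔_; _≤?_; _<?_; _≡ᵇ_; z≤n; s≤s; z<s)
open import Data.Nat.Combinatorics using (_C_; nC1≡n; nCk+nC[k+1]≡[n+1]C[k+1])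
open import Data.Nat.Properties
open import Data.Nat.Tactic.RingSolver using (solve-∀)
open import Data.Product using (∃; _×_; _,_; <_,_>; proj₁; proj₂; swap)
open import Data.Product.Properties using (≡-dec; ,-injectiveˡ; ,-injectiveʳ)
open import Data.Sum using (_⊎_; inj₁; inj₂)
open import Function.Base using (_∘_)
open import Function.Bundles using (_⇔_; mk⇔)
open import Function.Definitions using (Injective)
open import Relation.Binary.Definitions using (tri<; tri≈; tri>)
open import Relation.Binary.PropositionalEquality
  using (_≡_; _≢_; refl; sym; trans; cong; cong₂; subst; subst₂; module ≡-Reasoning)
open import Relation.Nullary using (Dec; yes; no)
open import Relation.Nullary.Decidable using (map′; _×-dec_; _→-dec_; from-yes)
open import Data.List.Membership.DecPropositional (≡-dec _≟_ _≟_) using (_∉?_)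
open import Data.List.Relation.Unary.Unique.DecPropositional (≡-dec _≟_ _≟_) using (unique?)

consIf : {A : Set} → Bool → A → List A → List A
consIf b x xs = if b then x ∷ xs else xs

All-consIf : ∀ {A : Set} {P : A → Set} b {x xs} → P x → All P xs → All P (consIf b x xs)
All-consIf true  px pxs = px ∷ pxs
All-consIf false px pxs = pxs

Unique-consIf : ∀ {A : Set} b {x : A} {xs} → All (x ≢_) xs → Unique xs → Unique (consIf b x xs)
Unique-consIf true  x∉xs u = x∉xs ∷ u
Unique-consIf false x∉xs u = u

Unique-tabulate⁻ : ∀ {A : Set} {n} {f : Fin n → A} → Unique (tabulate f) → Injective _≡_ _≡_ f
Unique-tabulate⁻ (f₀∉ ∷ u) {0F}       {0F}       _  = refl
Unique-tabulate⁻ (f₀∉ ∷ u) {0F}       {Fin.suc j} eq =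
  ⊥-elim (All.lookup f₀∉ (∈-tabulate⁺ j) eq)
Unique-tabulate⁻ (f₀∉ ∷ u) {Fin.suc i} {0F}       eq =
  ⊥-elim (All.lookup f₀∉ (∈-tabulate⁺ i) (sym eq))
Unique-tabulate⁻ (f₀∉ ∷ u) {Fin.suc i} {Fin.suc j} eq = cong Fin.suc (Unique-tabulate⁻ u eq)

Edge : Set
Edge = ℕ × ℕ

edge : ℕ → ℕ → Edge
edge a b = a ⊓ b , a ⊔ b

edge-comm : ∀ a b → edge a b ≡ edge b a
edge-comm a b = cong₂ _,_ (⊓-comm a b) (⊔-comm a b)

edge-≤ : ∀ {a b} → a ≤ b → edge a b ≡ (a , b)
edge-≤ a≤b = cong₂ _,_ (m≤n⇒m⊓n≡m a≤b) (m≤n⇒m⊔n≡n a≤b)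

edge-≥ : ∀ {a b} → b ≤ a → edge a b ≡ (b , a)
edge-≥ b≤a = cong₂ _,_ (m≥n⇒m⊓n≡n b≤a) (m≥n⇒m⊔n≡m b≤a)

edge-cases : ∀ a b → edge a b ≡ (a , b) ⊎ edge a b ≡ (b , a)
edge-cases a b with ≤-total a b
... | inj₁ a≤b = inj₁ (edge-≤ a≤b)
... | inj₂ b≤a = inj₂ (edge-≥ b≤a)

private
  ,-injective : ∀ {x y x' y' : ℕ} → (x , y) ≡ (x' , y') → x ≡ x' × y ≡ y'
  ,-injective = < ,-injectiveˡ , ,-injectiveʳ >

edge-injective : ∀ {a b a' b'} → edge a b ≡ edge a' b' →
                 (a ≡ a' × b ≡ b') ⊎ (a ≡ b' × b ≡ a')
edge-injective {a} {b} {a'} {b'} eq with edge-cases a b | edge-cases a' b'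
... | inj₁ p | inj₁ q = inj₁ (,-injective (trans (sym p) (trans eq q)))
... | inj₁ p | inj₂ q = inj₂ (,-injective (trans (sym p) (trans eq q)))
... | inj₂ p | inj₁ q = inj₂ (swap (,-injective (trans (sym p) (trans eq q))))
... | inj₂ p | inj₂ q = inj₁ (swap (,-injective (trans (sym p) (trans eq q))))

sameEdge⇒edge≡ : ∀ {k} {x y x' y' : Fin k} → SameEdge (x , y) (x' , y') →
                 edge (toℕ x) (toℕ y) ≡ edge (toℕ x') (toℕ y')
sameEdge⇒edge≡ (inj₁ (refl , refl)) = refl
sameEdge⇒edge≡ {x' = x'} {y'} (inj₂ (refl , refl)) = edge-comm (toℕ y') (toℕ x')

fst-≢ : ∀ {e e' : Edge} → proj₁ e ≢ proj₁ e' → e ≢ e'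
fst-≢ ne eq = ne (cong proj₁ eq)

snd-≢ : ∀ {e e' : Edge} → proj₂ e ≢ proj₂ e' → e ≢ e'
snd-≢ ne eq = ne (cong proj₂ eq)

-- Positions past the end read as 0, the centre: this is what closes a petal.
vertexAt : List ℕ → ℕ → ℕ
vertexAt []       _       = 0
vertexAt (v ∷ vs) zero    = v
vertexAt (v ∷ vs) (suc p) = vertexAt vs p

vertexAt-≥ : ∀ W {p} → length W ≤ p → vertexAt W p ≡ 0
vertexAt-≥ []       _         = refl
vertexAt-≥ (v ∷ vs) (s≤s le) = vertexAt-≥ vs le

vertexAt-< : ∀ {k} W → 0 < k → All (_< k) W → ∀ p → vertexAt W p < k
vertexAt-< []       0<k _          _       = 0<k
vertexAt-< (v ∷ vs) _   (v<k ∷ _)  zero    = v<k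
vertexAt-< (v ∷ vs) 0<k (_ ∷ vs<k) (suc p) = vertexAt-< vs 0<k vs<k p

walkEdges : ℕ → List ℕ → List Edge
walkEdges u []       = edge u 0 ∷ []
walkEdges u (v ∷ vs) = edge u v ∷ walkEdges v vs

petalEdges : List ℕ → List Edge
petalEdges = walkEdges 0

walkEdges≡tabulate : ∀ u W →
  walkEdges u W ≡ tabulate {n = suc (length W)}
                    (λ j → edge (vertexAt (u ∷ W) (toℕ j)) (vertexAt (u ∷ W) (suc (toℕ j))))
walkEdges≡tabulate u []       = refl
walkEdges≡tabulate u (v ∷ vs) = cong (edge u v ∷_) (walkEdges≡tabulate v vs)

walkEdges-++ : ∀ u W X → walkEdges u (W ++ 0 ∷ X) ≡ walkEdges u W ++ petalEdges X
walkEdges-++ u []       X = refl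
walkEdges-++ u (v ∷ vs) X = cong (edge u v ∷_) (walkEdges-++ v vs X)

walkEdges-consIf : ∀ b v W → walkEdges v (consIf b v W) ≡ consIf b (v , v) (walkEdges v W)
walkEdges-consIf true  v W = cong (_∷ walkEdges v W) (edge-≤ ≤-refl)
walkEdges-consIf false v W = refl

walkEdges-bounded : ∀ {k u W} → u < k → All (_< k) W → All (λ e → proj₂ e < k) (walkEdges u W)
walkEdges-bounded u<k []           = ⊔-lub u<k (≤-trans (s≤s z≤n) u<k) ∷ []
walkEdges-bounded u<k (v<k ∷ vs<k) = ⊔-lub u<k v<k ∷ walkEdges-bounded v<k vs<k

-- A petal of length c is given by the list W of the images of its c − 1 inner vertices,
-- the centre being vertex 0; petalEdges W lists the images (as (min, max) pairs) of its
-- c edges.  Two such petals, together with the loop at 0, describe an embedding of P_{1,c₂,c₃}.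
record PetalPair (k : ℕ) (W₁ W₂ : List ℕ) : Set where
  field
    bounded₁ : All (_< k) W₁
    bounded₂ : All (_< k) W₂
    unique₁  : Unique (petalEdges W₁)
    unique₂  : Unique (petalEdges W₂)
    disjoint : Disjoint (petalEdges W₁) (petalEdges W₂)
    loop∉₁   : (0 , 0) ∉ petalEdges W₁
    loop∉₂   : (0 , 0) ∉ petalEdges W₂

module _ {k : ℕ} {W₁ W₂ : List ℕ} (0<k : 0 < k) (pp : PetalPair k W₁ W₂) where
  open PetalPair pp

  private
    c : Fin 3 → ℕ
    c = petal1 (suc (length W₁)) (suc (length W₂))

    walk : Fin 3 → List ℕ
    walk 0F = []
    walk 1F = W₁
    walk 2F = W₂

    pred-c : ∀ i → pred (c i) ≡ length (walk i)
    pred-c 0F = refl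
    pred-c 1F = refl
    pred-c 2F = refl

    position : PVertex c → ℕ
    position nothing        = 0
    position (just (i , q)) = vertexAt (walk i) (toℕ q)

    position-node : ∀ i p → position (node c i p) ≡ vertexAt (0 ∷ walk i) p
    position-node i zero = refl
    position-node i (suc p) with p <? pred (c i)
    ... | yes p< = cong (vertexAt (walk i)) (Finₚ.toℕ-fromℕ< p<)
    ... | no p≮ = sym (vertexAt-≥ (walk i) (subst (_≤ p) (pred-c i) (≮⇒≥ p≮)))

    walk-bounded : ∀ i → All (_< k) (walk i)
    walk-bounded 0F = []
    walk-bounded 1F = bounded₁
    walk-bounded 2F = bounded₂

    position-< : ∀ v → position v < k
    position-< nothing        = 0<k
    position-< (just (i , q)) = vertexAt-< (walk i) 0<k (walk-bounded i) (toℕ q)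

    edgeImage : PEdge c → Edge
    edgeImage e = edge (position (proj₁ (ends c e))) (position (proj₂ (ends c e)))

    petalImage : ∀ i → Fin (c i) → Edge
    petalImage i j = edgeImage (i , j)

    petalImage≡ : ∀ i j →
      petalImage i j ≡ edge (vertexAt (0 ∷ walk i) (toℕ j)) (vertexAt (0 ∷ walk i) (suc (toℕ j)))
    petalImage≡ i j = cong₂ edge (position-node i (toℕ j)) (position-node i (suc (toℕ j)))

    tabulate-petalImage : ∀ i → tabulate (petalImage i) ≡ petalEdges (walk i)
    tabulate-petalImage 0F = trans (tabulate-cong (petalImage≡ 0F)) (sym (walkEdges≡tabulate 0 []))
    tabulate-petalImage 1F = trans (tabulate-cong (petalImage≡ 1F)) (sym (walkEdges≡tabulate 0 W₁))
    tabulate-petalImage 2F = trans (tabulate-cong (petalImage≡ 2F)) (sym (walkEdges≡tabulate 0 W₂))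

    walk-unique : ∀ i → Unique (petalEdges (walk i))
    walk-unique 0F = [] ∷ []
    walk-unique 1F = unique₁
    walk-unique 2F = unique₂

    loop-disjoint : ∀ {W} → (0 , 0) ∉ petalEdges W → Disjoint (petalEdges []) (petalEdges W)
    loop-disjoint loop∉ (here refl , loop∈) = loop∉ loop∈

    walks-disjoint : ∀ {i i'} → i ≢ i' → Disjoint (petalEdges (walk i)) (petalEdges (walk i'))
    walks-disjoint {0F} {0F} i≢i' = ⊥-elim (i≢i' refl)
    walks-disjoint {0F} {1F} _ = loop-disjoint loop∉₁
    walks-disjoint {0F} {2F} _ = loop-disjoint loop∉₂
    walks-disjoint {1F} {0F} _ = loop-disjoint loop∉₁ ∘ swap
    walks-disjoint {1F} {1F} i≢i' = ⊥-elim (i≢i' refl)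
    walks-disjoint {1F} {2F} _ = disjoint
    walks-disjoint {2F} {0F} _ = loop-disjoint loop∉₂ ∘ swap
    walks-disjoint {2F} {1F} _ = disjoint ∘ swap
    walks-disjoint {2F} {2F} i≢i' = ⊥-elim (i≢i' refl)

    petalImage∈ : ∀ i j → petalImage i j ∈ petalEdges (walk i)
    petalImage∈ i j = subst (petalImage i j ∈_) (tabulate-petalImage i) (∈-tabulate⁺ j)

    edgeImage-injective : Injective _≡_ _≡_ edgeImage
    edgeImage-injective {i , j} {i' , j'} eq with i Finₚ.≟ i'
    ... | yes refl =
      cong (i ,_) (Unique-tabulate⁻ (subst Unique (sym (tabulate-petalImage i)) (walk-unique i)) eq)
    ... | no i≢i' =
      ⊥-elim (walks-disjoint i≢i' (petalImage∈ i j , subst (_∈ _) (sym eq) (petalImage∈ i' j')))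

    vertexMap : PVertex c → Fin k
    vertexMap v = fromℕ< (position-< v)

  petalPair⇒embeds : EmbedsIn (petal1 (suc (length W₁)) (suc (length W₂))) k
  petalPair⇒embeds = vertexMap , λ e e' same →
    edgeImage-injective (trans (sym (toℕ-image e)) (trans (sameEdge⇒edge≡ same) (toℕ-image e')))
    where
    toℕ-image : ∀ e →
      edge (toℕ (vertexMap (proj₁ (ends c e)))) (toℕ (vertexMap (proj₂ (ends c e)))) ≡ edgeImage e
    toℕ-image e = cong₂ edge (Finₚ.toℕ-fromℕ< _) (Finₚ.toℕ-fromℕ< _)

-- Counting edges

triangle : ℕ → ℕ
triangle zero    = 0
triangle (suc n) = suc n + triangle n

triangle≡C : ∀ n → triangle n ≡ (n + 1) C 2
triangle≡C n = trans (triangle≡sucC n) (cong (_C 2) (+-comm 1 n))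
  where
  triangle≡sucC : ∀ n → triangle n ≡ suc n C 2
  triangle≡sucC zero    = refl
  triangle≡sucC (suc n) = trans (cong₂ _+_ (sym (nC1≡n (suc n))) (triangle≡sucC n))
                                (nCk+nC[k+1]≡[n+1]C[k+1] (suc n) 1)

triangle-mono : ∀ {m n} → m ≤ n → triangle m ≤ triangle n
triangle-mono {zero}           _          = z≤n
triangle-mono {suc m} {suc n} (s≤s m≤n) = +-mono-≤ (s≤s m≤n) (triangle-mono m≤n)

triangle+<triangle : ∀ {m x} → x ≤ m → triangle m + x < triangle (suc m)
triangle+<triangle {m} {x} x≤m =
  s≤s (subst (triangle m + x ≤_) (+-comm (triangle m) m) (+-monoʳ-≤ (triangle m) x≤m))

triangle+<triangle+ : ∀ {m m' x} x' → x ≤ m → m < m' → triangle m + x < triangle m' + x'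
triangle+<triangle+ x' x≤m m<m' =
  <-≤-trans (triangle+<triangle x≤m) (≤-trans (triangle-mono m<m') (m≤m+n _ x'))

triangle+-injective : ∀ {m x m' x'} → x ≤ m → x' ≤ m' →
                      triangle m + x ≡ triangle m' + x' → m ≡ m' × x ≡ x'
triangle+-injective {m} {x} {m'} {x'} x≤m x'≤m' eq with <-cmp m m'
... | tri≈ _ refl _ = refl , +-cancelˡ-≡ (triangle m) x x' eq
... | tri< m<m' _ _ = ⊥-elim (<⇒≢ (triangle+<triangle+ x' x≤m m<m') eq)
... | tri> _ _ m>m' = ⊥-elim (<⇒≢ (triangle+<triangle+ x x'≤m' m>m') (sym eq))

-- Edges of K_k^* are numbered row by row: {a, b} with a ≤ b gets the code triangle b + a.
edgeCode : ∀ {k} → Fin k → Fin k → Fin (triangle k)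
edgeCode {k} x y = fromℕ< (<-≤-trans (triangle+<triangle (m⊓n≤m⊔n (toℕ x) (toℕ y)))
                                     (triangle-mono (⊔-lub (Finₚ.toℕ<n x) (Finₚ.toℕ<n y))))

edgeCode-injective : ∀ {k} {x y x' y' : Fin k} →
                     edgeCode x y ≡ edgeCode x' y' → SameEdge (x , y) (x' , y')
edgeCode-injective {x = x} {y} {x'} {y'} eq
  with triangle+-injective (m⊓n≤m⊔n (toℕ x) (toℕ y)) (m⊓n≤m⊔n (toℕ x') (toℕ y'))
                           (Finₚ.fromℕ<-injective _ _ _ _ eq)
... | max≡ , min≡ with edge-injective (cong₂ _,_ min≡ max≡)
...   | inj₁ (x≡ , y≡) = inj₁ (Finₚ.toℕ-injective x≡ , Finₚ.toℕ-injective y≡)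
...   | inj₂ (x≡ , y≡) = inj₂ (Finₚ.toℕ-injective x≡ , Finₚ.toℕ-injective y≡)

edgeCodeMap : ∀ {m} (c : Fin m → ℕ) {k} → (PVertex c → Fin k) → PEdge c → Fin (triangle k)
edgeCodeMap c f e = edgeCode (f (proj₁ (ends c e))) (f (proj₂ (ends c e)))

edgeCodeMap-injective : ∀ {m} {c : Fin m → ℕ} {k} (f : PVertex c → Fin k) → IsEmbedding c k f →
                        Injective _≡_ _≡_ (edgeCodeMap c f)
edgeCodeMap-injective f isEmb {e} {e'} eq = isEmb e e' (edgeCode-injective eq)

module _ (c₂ c₃ : ℕ) where
  private
    c : Fin 3 → ℕ
    c = petal1 c₂ c₃

  petalEdgeIndex : Fin (suc (c₂ + c₃)) → PEdge c
  petalEdgeIndex 0F           = 0F , 0F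
  petalEdgeIndex (Fin.suc i) with splitAt c₂ i
  ... | inj₁ j = 1F , j
  ... | inj₂ j = 2F , j

  petalEdgeIndex-injective : Injective _≡_ _≡_ petalEdgeIndex
  petalEdgeIndex-injective {i} {i'} eq =
    trans (sym (unindex-index i)) (trans (cong unindex eq) (unindex-index i'))
    where
    unindex : PEdge c → Fin (suc (c₂ + c₃))
    unindex (0F , 0F) = 0F
    unindex (1F , j)  = Fin.suc (j ↑ˡ c₃)
    unindex (2F , j)  = Fin.suc (c₂ ↑ʳ j)
    unindex-index : ∀ i → unindex (petalEdgeIndex i) ≡ i
    unindex-index 0F = refl
    unindex-index (Fin.suc i) with splitAt c₂ i in eq
    ... | inj₁ j = cong Fin.suc (trans (cong (join c₂ c₃) (sym eq)) (Finₚ.join-splitAt c₂ c₃ i))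
    ... | inj₂ j = cong Fin.suc (trans (cong (join c₂ c₃) (sym eq)) (Finₚ.join-splitAt c₂ c₃ i))

embeds⇒size≤ : ∀ {c₂ c₃ k} → EmbedsIn (petal1 c₂ c₃) k → 1 + c₂ + c₃ ≤ triangle k
embeds⇒size≤ {c₂} {c₃} (f , isEmb) =
  Finₚ.injective⇒≤ {f = edgeCodeMap (petal1 c₂ c₃) f ∘ petalEdgeIndex c₂ c₃}
                   (petalEdgeIndex-injective c₂ c₃ ∘ edgeCodeMap-injective f isEmb)

-- A 1-petal would duplicate the loop at u₀, and a 2-petal is a double edge.
embeds⇒3≤c₂ : ∀ {c₂ c₃ k} → 1 ≤ c₂ → EmbedsIn (petal1 c₂ c₃) k → 3 ≤ c₂
embeds⇒3≤c₂ {suc zero} _ (_ , isEmb) with isEmb (1F , 0F) (0F , 0F) (inj₁ (refl , refl))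
... | ()
embeds⇒3≤c₂ {suc (suc zero)} _ (_ , isEmb) with isEmb (1F , 0F) (1F , 1F) (inj₂ (refl , refl))
... | ()
embeds⇒3≤c₂ {suc (suc (suc _))} _ _ = s≤s (s≤s (s≤s z≤n))

-- Realising petal lengths by walks

Realises : ℕ → ℕ → ℕ → List ℕ × List ℕ → Set
Realises k a b (W₁ , W₂) = suc (length W₁) ≡ a × suc (length W₂) ≡ b × PetalPair k W₁ W₂

Realisable : ℕ → ℕ → ℕ → Set
Realisable k a b = ∃ (Realises k a b)

realisable⇒embeds : ∀ {k a b} → 0 < k → Realisable k a b → EmbedsIn (petal1 a b) k
realisable⇒embeds 0<k ((W₁ , W₂) , refl , refl , pp) = petalPair⇒embeds 0<k pp

PetalPair-swap : ∀ {k W₁ W₂} → PetalPair k W₁ W₂ → PetalPair k W₂ W₁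
PetalPair-swap pp = record
  { bounded₁ = bounded₂ ; bounded₂ = bounded₁
  ; unique₁ = unique₂ ; unique₂ = unique₁
  ; disjoint = disjoint ∘ swap
  ; loop∉₁ = loop∉₂ ; loop∉₂ = loop∉₁
  }
  where open PetalPair pp

PetalPair-mono : ∀ {k k' W₁ W₂} → k ≤ k' → PetalPair k W₁ W₂ → PetalPair k' W₁ W₂
PetalPair-mono k≤k' pp = record
  { bounded₁ = All.map (λ v<k → <-≤-trans v<k k≤k') bounded₁
  ; bounded₂ = All.map (λ v<k → <-≤-trans v<k k≤k') bounded₂
  ; unique₁ = unique₁ ; unique₂ = unique₂
  ; disjoint = disjoint
  ; loop∉₁ = loop∉₁ ; loop∉₂ = loop∉₂
  }
  where open PetalPair pp

realisable-swap : ∀ {k a b} → Realisable k a b → Realisable k b a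
realisable-swap ((W₁ , W₂) , ℓ₁ , ℓ₂ , pp) = (W₂ , W₁) , ℓ₂ , ℓ₁ , PetalPair-swap pp

realisable-mono : ∀ {k k' a b} → k ≤ k' → Realisable k a b → Realisable k' a b
realisable-mono k≤k' (Ws , ℓ₁ , ℓ₂ , pp) = Ws , ℓ₁ , ℓ₂ , PetalPair-mono k≤k' pp

AllRealisable : ℕ → Set
AllRealisable k = ∀ a b → 3 ≤ a → a ≤ b → 1 + a + b ≤ triangle k → Realisable k a b

allRealisable-unordered : ∀ {k} → AllRealisable k →
                          ∀ a b → 3 ≤ a → 3 ≤ b → 1 + a + b ≤ triangle k → Realisable k a b
allRealisable-unordered {k} realise a b 3≤a 3≤b size≤ with ≤-total a b
... | inj₁ a≤b = realise a b 3≤a a≤b size≤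
... | inj₂ b≤a =
  realisable-swap (realise b a 3≤b b≤a (subst (_≤ triangle k) (cong suc (+-comm a b)) size≤))

-- The closed walk 0 k [k] (k+1) [k+1] (2p−1) k (2p) (k+1) … 1 k 2 (k+1) 0, the loops at k and
-- k + 1 being present when l₀ and l₁ hold.  All its edges end at a new vertex k or k + 1.
module Detour (k : ℕ) where

  zigzag : ℕ → List ℕ
  zigzag zero    = []
  zigzag (suc p) = suc (2 * p) ∷ k ∷ suc (suc (2 * p)) ∷ suc k ∷ zigzag p

  detour : ℕ → Bool → Bool → List ℕ
  detour p l₀ l₁ = k ∷ consIf l₀ k (suc k ∷ consIf l₁ (suc k) (zigzag p))

  detourLength : ℕ → Bool → Bool → ℕ
  detourLength p l₀ l₁ = suc (length (detour p l₀ l₁))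

  zigzagEdges : ℕ → List Edge
  zigzagEdges zero    = (0 , suc k) ∷ []
  zigzagEdges (suc p) = (suc (2 * p) , suc k) ∷ (suc (2 * p) , k) ∷
                        (suc (suc (2 * p)) , k) ∷ (suc (suc (2 * p)) , suc k) ∷ zigzagEdges p

  detourEdges : ℕ → Bool → Bool → List Edge
  detourEdges p l₀ l₁ =
    (0 , k) ∷ consIf l₀ (k , k) ((k , suc k) ∷ consIf l₁ (suc k , suc k) (zigzagEdges p))

  private
    2p+2<k : ∀ {p} → 2 * suc p < k → suc (suc (2 * p)) < k
    2p+2<k {p} = subst (_< k) (*-suc 2 p)

  walkEdges-zigzag : ∀ {p} → 2 * p < k → walkEdges (suc k) (zigzag p) ≡ zigzagEdges p
  walkEdges-zigzag {zero}  _     = cong (_∷ []) (edge-≥ z≤n)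
  walkEdges-zigzag {suc p} 2p<k =
    cong₂ _∷_ (edge-≥ (m≤n⇒m≤1+n 2p+1≤k)) (cong₂ _∷_ (edge-≤ 2p+1≤k)
      (cong₂ _∷_ (edge-≥ 2p+2≤k) (cong₂ _∷_ (edge-≤ (m≤n⇒m≤1+n 2p+2≤k))
        (walkEdges-zigzag (<-trans (n<1+n _) (<-trans (n<1+n _) (2p+2<k 2p<k)))))))
    where
    2p+2≤k : suc (suc (2 * p)) ≤ k
    2p+2≤k = <⇒≤ (2p+2<k 2p<k)
    2p+1≤k : suc (2 * p) ≤ k
    2p+1≤k = ≤-trans (n≤1+n _) 2p+2≤k

  petalEdges-detour : ∀ {p} l₀ l₁ → 2 * p < k → petalEdges (detour p l₀ l₁) ≡ detourEdges p l₀ l₁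
  petalEdges-detour {p} l₀ l₁ 2p<k =
    cong₂ _∷_ (edge-≤ z≤n) (trans (walkEdges-consIf l₀ k _) (cong (consIf l₀ (k , k))
      (cong₂ _∷_ (edge-≤ (n≤1+n k)) (trans (walkEdges-consIf l₁ (suc k) _) (cong (consIf l₁ (suc k , suc k))
        (walkEdges-zigzag 2p<k))))))

  private
    n≢1+n : ∀ {n} → n ≢ suc n
    n≢1+n = <⇒≢ (n<1+n _)

  zigzagEdges-low : ∀ p → All (λ e → proj₁ e ≤ 2 * p) (zigzagEdges p)
  zigzagEdges-low zero    = z≤n ∷ []
  zigzagEdges-low (suc p) rewrite *-suc 2 p =
    n≤1+n _ ∷ n≤1+n _ ∷ ≤-refl ∷ ≤-refl ∷
    All.map (λ le → m≤n⇒m≤1+n (m≤n⇒m≤1+n le)) (zigzagEdges-low p)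

  zigzagEdges-high : ∀ p → All (λ e → k ≤ proj₂ e) (zigzagEdges p)
  zigzagEdges-high zero    = n≤1+n k ∷ []
  zigzagEdges-high (suc p) = n≤1+n k ∷ ≤-refl ∷ ≤-refl ∷ n≤1+n k ∷ zigzagEdges-high p

  zigzagEdges-above : ∀ p {v w} → 2 * p < v → All ((v , w) ≢_) (zigzagEdges p)
  zigzagEdges-above p 2p<v = All.map (λ le → fst-≢ (>⇒≢ (≤-<-trans le 2p<v))) (zigzagEdges-low p)

  zigzagEdges-unique : ∀ p → Unique (zigzagEdges p)
  zigzagEdges-unique zero    = [] ∷ []
  zigzagEdges-unique (suc p) =
    (snd-≢ 1+n≢n ∷ fst-≢ n≢1+n ∷ fst-≢ n≢1+n ∷ zigzagEdges-above p (n<1+n _)) ∷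
    (fst-≢ n≢1+n ∷ fst-≢ n≢1+n ∷ zigzagEdges-above p (n<1+n _)) ∷
    (snd-≢ n≢1+n ∷ zigzagEdges-above p (m<n⇒m<1+n (n<1+n _))) ∷
    zigzagEdges-above p (m<n⇒m<1+n (n<1+n _)) ∷
    zigzagEdges-unique p

  0k∉zigzagEdges : ∀ p → All ((0 , k) ≢_) (zigzagEdges p)
  0k∉zigzagEdges zero    = snd-≢ n≢1+n ∷ []
  0k∉zigzagEdges (suc p) =
    fst-≢ (λ ()) ∷ fst-≢ (λ ()) ∷ fst-≢ (λ ()) ∷ fst-≢ (λ ()) ∷ 0k∉zigzagEdges p

  detourEdges-high : ∀ p l₀ l₁ → All (λ e → k ≤ proj₂ e) (detourEdges p l₀ l₁)
  detourEdges-high p l₀ l₁ =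
    ≤-refl ∷ All-consIf l₀ ≤-refl (n≤1+n k ∷ All-consIf l₁ (n≤1+n k) (zigzagEdges-high p))

  detourEdges-unique : ∀ {p} l₀ l₁ → 2 * p < k → Unique (detourEdges p l₀ l₁)
  detourEdges-unique {p} l₀ l₁ 2p<k =
    All-consIf l₀ (fst-≢ (<⇒≢ (≤-<-trans z≤n 2p<k)))
                  (snd-≢ n≢1+n ∷ All-consIf l₁ (snd-≢ n≢1+n) (0k∉zigzagEdges p)) ∷
    Unique-consIf l₀ (snd-≢ n≢1+n ∷ All-consIf l₁ (fst-≢ n≢1+n) (zigzagEdges-above p 2p<k))
      (All-consIf l₁ (fst-≢ n≢1+n) (zigzagEdges-above p 2p<k) ∷
       Unique-consIf l₁ (zigzagEdges-above p (m<n⇒m<1+n 2p<k)) (zigzagEdges-unique p))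

  detour-bounded : ∀ {p} l₀ l₁ → 2 * p < k → All (_< 2 + k) (detour p l₀ l₁)
  detour-bounded {p} l₀ l₁ 2p<k =
    k<2+k ∷ All-consIf l₀ k<2+k (n<1+n _ ∷ All-consIf l₁ (n<1+n _) (zigzag-bounded p 2p<k))
    where
    k<2+k : k < 2 + k
    k<2+k = m<n⇒m<1+n (n<1+n k)
    zigzag-bounded : ∀ p → 2 * p < k → All (_< 2 + k) (zigzag p)
    zigzag-bounded zero    _    = []
    zigzag-bounded (suc p) 2p<k =
      <-trans 2p+1<k k<2+k ∷ k<2+k ∷ <-trans (2p+2<k 2p<k) k<2+k ∷ n<1+n _ ∷
      zigzag-bounded p (<-trans (n<1+n _) 2p+1<k)
      where
      2p+1<k : suc (2 * p) < k
      2p+1<k = <-trans (n<1+n _) (2p+2<k 2p<k)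

  PetalPair-extend : ∀ {p W₁ W₂} l₀ l₁ → 2 * p < k → PetalPair k W₁ W₂ →
                     PetalPair (2 + k) W₁ (W₂ ++ 0 ∷ detour p l₀ l₁)
  PetalPair-extend {p} {W₁} {W₂} l₀ l₁ 2p<k pp = record
    { bounded₁ = All.map widen bounded₁
    ; bounded₂ = Allₚ.++⁺ (All.map widen bounded₂) (z<s ∷ detour-bounded l₀ l₁ 2p<k)
    ; unique₁  = unique₁
    ; unique₂  = subst Unique (sym edges≡)
                   (Uniqueₚ.++⁺ unique₂ (detourEdges-unique l₀ l₁ 2p<k)
                                (λ (e∈old , e∈new) → new∌ (low bounded₂ e∈old) e∈new))
    ; disjoint = λ (e∈₁ , e∈₂) →
                   ∉-extended (λ e∈W₂ → disjoint (e∈₁ , e∈W₂)) (low bounded₁ e∈₁) e∈₂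
    ; loop∉₁   = loop∉₁
    ; loop∉₂   = ∉-extended loop∉₂ 0<k
    }
    where
    open PetalPair pp
    0<k : 0 < k
    0<k = ≤-<-trans z≤n 2p<k
    widen : ∀ {v} → v < k → v < 2 + k
    widen v<k = <-trans v<k (m<n⇒m<1+n (n<1+n k))
    edges≡ : petalEdges (W₂ ++ 0 ∷ detour p l₀ l₁) ≡ petalEdges W₂ ++ detourEdges p l₀ l₁
    edges≡ = trans (walkEdges-++ 0 W₂ _) (cong (petalEdges W₂ ++_) (petalEdges-detour l₀ l₁ 2p<k))
    low : ∀ {W e} → All (_< k) W → e ∈ petalEdges W → proj₂ e < k
    low W<k e∈ = All.lookup (walkEdges-bounded 0<k W<k) e∈
    new∌ : ∀ {e} → proj₂ e < k → e ∉ detourEdges p l₀ l₁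
    new∌ e<k e∈ = <⇒≱ e<k (All.lookup (detourEdges-high p l₀ l₁) e∈)
    ∉-extended : ∀ {e} → e ∉ petalEdges W₂ → proj₂ e < k →
                 e ∉ petalEdges (W₂ ++ 0 ∷ detour p l₀ l₁)
    ∉-extended {e} e∉ e<k e∈ with ∈-++⁻ (petalEdges W₂) (subst (e ∈_) edges≡ e∈)
    ... | inj₁ e∈old = e∉ e∈old
    ... | inj₂ e∈new = new∌ e<k e∈new

  realisable-extend : ∀ {a b p} l₀ l₁ → 2 * p < k → Realisable k a b →
                      Realisable (2 + k) a (b + detourLength p l₀ l₁)
  realisable-extend {p = p} l₀ l₁ 2p<k ((W₁ , W₂) , ℓ₁ , refl , pp) =
    (W₁ , W₂ ++ 0 ∷ detour p l₀ l₁) , ℓ₁ , cong suc (length-++ W₂) ,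
    PetalPair-extend l₀ l₁ 2p<k pp

  detourLength-suc : ∀ p l₀ l₁ → detourLength (suc p) l₀ l₁ ≡ 4 + detourLength p l₀ l₁
  detourLength-suc p true  true  = refl
  detourLength-suc p true  false = refl
  detourLength-suc p false true  = refl
  detourLength-suc p false false = refl

  -- Detour lengths are 4p + 3 + l₀ + l₁, so every e ≥ 1 is at most 2 below one of them.
  detourLength-covers : ∀ j e → 1 ≤ e → e ≤ detourLength j true true →
    ∃ λ p → ∃ λ l₀ → ∃ λ l₁ → p ≤ j × e ≤ detourLength p l₀ l₁ × detourLength p l₀ l₁ ≤ 2 + e
  detourLength-covers j 1 _ _ = 0 , false , false , z≤n , s≤s z≤n , ≤-refl
  detourLength-covers j 2 _ _ = 0 , false , false , z≤n , s≤s (s≤s z≤n) , n≤1+n _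
  detourLength-covers j 3 _ _ = 0 , false , false , z≤n , ≤-refl , m≤n⇒m≤1+n (n≤1+n _)
  detourLength-covers j 4 _ _ = 0 , true , false , z≤n , ≤-refl , m≤n⇒m≤1+n (n≤1+n _)
  detourLength-covers j 5 _ _ = 0 , true , true , z≤n , ≤-refl , m≤n⇒m≤1+n (n≤1+n _)
  detourLength-covers zero (suc (suc (suc (suc (suc (suc _)))))) _ (s≤s (s≤s (s≤s (s≤s (s≤s ())))))
  detourLength-covers (suc j) (suc (suc (suc (suc (suc (suc e)))))) _ (s≤s (s≤s (s≤s (s≤s e≤))))
    with detourLength-covers j (suc (suc e)) (s≤s z≤n) e≤
  ... | p , l₀ , l₁ , p≤j , e≤h , h≤2+e =
    suc p , l₀ , l₁ , s≤s p≤j ,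
    subst (6 + e ≤_) (sym (detourLength-suc p l₀ l₁)) (+-monoʳ-≤ 4 e≤h) ,
    subst (_≤ 8 + e) (sym (detourLength-suc p l₀ l₁)) (+-monoʳ-≤ 4 h≤2+e)

  length-zigzag : ∀ p → length (zigzag p) ≡ 4 * p
  length-zigzag zero    = refl
  length-zigzag (suc p) = trans (cong (4 +_) (length-zigzag p)) (sym (*-suc 4 p))

-- The induction step

excess-exists : ∀ {T L n} → T < n → n ≤ T + L → ∃ λ e → 1 ≤ e × e ≤ L × T + e ≡ n
excess-exists {T} {L} {n} T<n n≤T+L =
  suc d , s≤s z≤n , +-cancelˡ-≤ T _ _ (subst (_≤ T + L) (sym T+e≡n) n≤T+L) , T+e≡n
  where
  d : ℕ
  d = proj₁ (m≤n⇒∃[o]m+o≡n T<n)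
  T+e≡n : T + suc d ≡ n
  T+e≡n = trans (+-suc T d) (proj₂ (m≤n⇒∃[o]m+o≡n T<n))

smaller+6≤T : ∀ {T L a b} → L + 11 ≤ T → a ≤ b → 1 + a + b ≤ T + L → a + 6 ≤ T
smaller+6≤T {T} {L} {a} {b} L+11≤T a≤b size≤ = *-cancelˡ-≤ 2 (begin
  2 * (a + 6)     ≡⟨ double a ⟩
  1 + a + a + 11  ≤⟨ +-monoˡ-≤ 11 (+-monoʳ-≤ (1 + a) a≤b) ⟩
  1 + a + b + 11  ≤⟨ +-monoˡ-≤ 11 size≤ ⟩
  T + L + 11      ≡⟨ +-assoc T L 11 ⟩
  T + (L + 11)    ≤⟨ +-monoʳ-≤ T L+11≤T ⟩
  T + T           ≡⟨ sym (twice T) ⟩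
  2 * T           ∎)
  where
  open ≤-Reasoning
  double : ∀ a → 2 * (a + 6) ≡ 1 + a + a + 11
  double = solve-∀
  twice : ∀ T → 2 * T ≡ T + T
  twice = solve-∀

shorten : ∀ {T a b e h} → a + 6 ≤ T → T + e ≡ 1 + a + b → e ≤ h → h ≤ 2 + e →
          ∃ λ b' → b ≡ b' + h × 3 ≤ b' × 1 + a + b' ≤ T
shorten {T} {a} {b} {e} {h} a+6≤T T+e≡size e≤h h≤2+e = 3 + o , b≡ , m≤m+n 3 o , size'≤T
  where
  open ≤-Reasoning
  e+5≤b : e + 5 ≤ b
  e+5≤b = +-cancelˡ-≤ T _ _ (begin
    T + (e + 5)   ≡⟨ sym (+-assoc T e 5) ⟩
    T + e + 5     ≡⟨ cong (_+ 5) T+e≡size ⟩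
    1 + a + b + 5 ≡⟨ shuffle a b ⟩
    a + 6 + b     ≤⟨ +-monoˡ-≤ b a+6≤T ⟩
    T + b         ∎)
    where
    shuffle : ∀ a b → 1 + a + b + 5 ≡ a + 6 + b
    shuffle = solve-∀
  h+3≤b : h + 3 ≤ b
  h+3≤b = ≤-trans (+-monoˡ-≤ 3 h≤2+e) (subst (_≤ b) (shift e) e+5≤b)
    where
    shift : ∀ e → e + 5 ≡ 2 + e + 3
    shift = solve-∀
  o : ℕ
  o = proj₁ (m≤n⇒∃[o]m+o≡n h+3≤b)
  b≡ : b ≡ 3 + o + h
  b≡ = trans (sym (proj₂ (m≤n⇒∃[o]m+o≡n h+3≤b))) (reorder h o)
    where
    reorder : ∀ h o → h + 3 + o ≡ 3 + o + h
    reorder = solve-∀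
  size'≤T : 1 + a + (3 + o) ≤ T
  size'≤T = +-cancelʳ-≤ h _ _ (begin
    1 + a + (3 + o) + h   ≡⟨ +-assoc (1 + a) (3 + o) h ⟩
    1 + a + (3 + o + h)   ≡⟨ cong (1 + a +_) (sym b≡) ⟩
    1 + a + b             ≡⟨ sym T+e≡size ⟩
    T + e                 ≤⟨ +-monoʳ-≤ T e≤h ⟩
    T + h                 ∎)

triangle-double : ∀ n → 2 * triangle n ≡ n * suc n
triangle-double zero    = refl
triangle-double (suc n) = begin
  2 * (suc n + triangle n)          ≡⟨ *-distribˡ-+ 2 (suc n) (triangle n) ⟩
  2 * suc n + 2 * triangle n        ≡⟨ cong (2 * suc n +_) (triangle-double n) ⟩
  2 * suc n + n * suc n             ≡⟨ factor n ⟩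
  suc n * suc (suc n)               ∎
  where
  open ≡-Reasoning
  factor : ∀ n → 2 * suc n + n * suc n ≡ suc n * suc (suc n)
  factor = solve-∀

triangle-odd-step : ∀ j → triangle (3 + 2 * j) ≡ triangle (1 + 2 * j) + (5 + 4 * j)
triangle-odd-step j = unfolded j (triangle (1 + 2 * j))
  where
  unfolded : ∀ j T → 3 + 2 * j + (2 + 2 * j + T) ≡ T + (5 + 4 * j)
  unfolded = solve-∀

triangle-odd-large : ∀ {j} → 3 ≤ j → 5 + 4 * j + 11 ≤ triangle (1 + 2 * j)
triangle-odd-large 3≤j with m≤n⇒∃[o]m+o≡n 3≤j
... | i , refl = *-cancelˡ-≤ 2 (begin
  2 * (5 + 4 * (3 + i) + 11)                          ≤⟨ m≤m+n _ (22 * i + 4 * (i * i)) ⟩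
  2 * (5 + 4 * (3 + i) + 11) + (22 * i + 4 * (i * i)) ≡⟨ expand i ⟩
  (1 + 2 * (3 + i)) * suc (1 + 2 * (3 + i))           ≡⟨ sym (triangle-double (1 + 2 * (3 + i))) ⟩
  2 * triangle (1 + 2 * (3 + i))                      ∎)
  where
  open ≤-Reasoning
  expand : ∀ i → 2 * (5 + 4 * (3 + i) + 11) + (22 * i + 4 * (i * i)) ≡
                 (1 + 2 * (3 + i)) * (2 + 2 * (3 + i))
  expand = solve-∀

allRealisable-step : ∀ j → 3 ≤ j → AllRealisable (1 + 2 * j) → AllRealisable (3 + 2 * j)
allRealisable-step j 3≤j realise a b 3≤a a≤b size≤ with 1 + a + b ≤? triangle (1 + 2 * j)
... | yes old = realisable-mono (m≤n⇒m≤1+n (n≤1+n _)) (realise a b 3≤a a≤b old)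
... | no ¬old =
  let e , 1≤e , e≤L , T+e≡size      = excess-exists (≰⇒> ¬old) size≤T+L
      p , l₀ , l₁ , p≤j , e≤h , h≤2+e = detourLength-covers j e 1≤e e≤L
      b' , b≡ , 3≤b' , size'≤T       = shorten (smaller+6≤T L+11≤T a≤b size≤T+L)
                                                 T+e≡size e≤h h≤2+e
  in subst (Realisable (3 + 2 * j) a) (sym b≡)
       (realisable-extend l₀ l₁ (s≤s (*-monoʳ-≤ 2 p≤j))
                          (allRealisable-unordered realise a b' 3≤a 3≤b' size'≤T))
  where
  open Detour (1 + 2 * j)
  L≡ : detourLength j true true ≡ 5 + 4 * j
  L≡ = cong (5 +_) (length-zigzag j)
  size≤T+L : 1 + a + b ≤ triangle (1 + 2 * j) + detourLength j true true
  size≤T+L =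
    subst (1 + a + b ≤_) (trans (triangle-odd-step j) (cong (triangle (1 + 2 * j) +_) (sym L≡))) size≤
  L+11≤T : detourLength j true true + 11 ≤ triangle (1 + 2 * j)
  L+11≤T = subst (λ L → L + 11 ≤ triangle (1 + 2 * j)) (sym L≡) (triangle-odd-large 3≤j)

-- The base cases k = 5 and k = 7

disjoint? : (xs ys : List Edge) → Dec (Disjoint xs ys)
disjoint? xs ys = map′ (λ xs∉ys (v∈xs , v∈ys) → All.lookup xs∉ys v∈xs v∈ys)
                       (λ disj → All.tabulate (λ v∈xs v∈ys → disj (v∈xs , v∈ys)))
                       (all? (_∉? ys) xs)

petalPair? : ∀ k W₁ W₂ → Dec (PetalPair k W₁ W₂)
petalPair? k W₁ W₂ =
  map′ (λ (b₁ , b₂ , u₁ , u₂ , d , l₁ , l₂) → record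
          { bounded₁ = b₁ ; bounded₂ = b₂ ; unique₁ = u₁ ; unique₂ = u₂
          ; disjoint = λ {v} → d {v} ; loop∉₁ = l₁ ; loop∉₂ = l₂ })
       (λ pp → let open PetalPair pp in
          bounded₁ , bounded₂ , unique₁ , unique₂ , (λ {v} → disjoint {v}) , loop∉₁ , loop∉₂)
       (all? (_<? k) W₁ ×-dec all? (_<? k) W₂ ×-dec
        unique? (petalEdges W₁) ×-dec unique? (petalEdges W₂) ×-dec
        disjoint? (petalEdges W₁) (petalEdges W₂) ×-dec
        (0 , 0) ∉? petalEdges W₁ ×-dec (0 , 0) ∉? petalEdges W₂)

realises? : ∀ k a b Ws → Dec (Realises k a b Ws)
realises? k a b (W₁ , W₂) = suc (length W₁) ≟ a ×-dec suc (length W₂) ≟ b ×-dec petalPair? k W₁ W₂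

Table : Set
Table = List (ℕ × ℕ × List ℕ × List ℕ)

walksFor : Table → ℕ → ℕ → List ℕ × List ℕ
walksFor []                   _ _ = [] , []
walksFor ((a' , b' , Ws) ∷ t) a b = if (a' ≡ᵇ a) ∧ (b' ≡ᵇ b) then Ws else walksFor t a b

Covers : ℕ → Table → ℕ → ℕ → Set
Covers k t a b = 3 ≤ a → a ≤ b → 1 + a + b ≤ triangle k → Realises k a b (walksFor t a b)

covers? : ∀ k t a b → Dec (Covers k t a b)
covers? k t a b =
  3 ≤? a →-dec a ≤? b →-dec 1 + a + b ≤? triangle k →-dec realises? k a b (walksFor t a b)

TableCovers : ℕ → Table → Set
TableCovers k t = ∀ (a b : Fin (triangle k)) → Covers k t (toℕ a) (toℕ b)

tableCovers? : ∀ k t → Dec (TableCovers k t)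
tableCovers? k t = Finₚ.all? λ a → Finₚ.all? λ b → covers? k t (toℕ a) (toℕ b)

covers⇒allRealisable : ∀ {k} t → TableCovers k t → AllRealisable k
covers⇒allRealisable {k} t covers a b 3≤a a≤b size≤ =
  walksFor t a b , subst₂ (Covers k t) (Finₚ.toℕ-fromℕ< a<) (Finₚ.toℕ-fromℕ< b<)
                          (covers (fromℕ< a<) (fromℕ< b<)) 3≤a a≤b size≤
  where
  a< : a < triangle k
  a< = <-≤-trans (s≤s (m≤m+n a b)) size≤
  b< : b < triangle k
  b< = <-≤-trans (s≤s (m≤n+m b a)) size≤

-- Walks found by computer search.
table₅ : Table
table₅ =
  (3 , 3 , (4 ∷ 3 ∷ []) , (2 ∷ 1 ∷ [])) ∷
  (3 , 4 , (4 ∷ 3 ∷ []) , (2 ∷ 2 ∷ 1 ∷ [])) ∷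
  (3 , 5 , (1 ∷ 4 ∷ []) , (2 ∷ 2 ∷ 1 ∷ 3 ∷ [])) ∷
  (3 , 6 , (3 ∷ 4 ∷ []) , (2 ∷ 2 ∷ 3 ∷ 1 ∷ 1 ∷ [])) ∷
  (3 , 7 , (4 ∷ 2 ∷ []) , (3 ∷ 2 ∷ 1 ∷ 4 ∷ 3 ∷ 1 ∷ [])) ∷
  (3 , 8 , (1 ∷ 2 ∷ []) , (4 ∷ 2 ∷ 3 ∷ 1 ∷ 1 ∷ 4 ∷ 3 ∷ [])) ∷
  (3 , 9 , (1 ∷ 2 ∷ []) , (4 ∷ 2 ∷ 3 ∷ 1 ∷ 1 ∷ 4 ∷ 3 ∷ 3 ∷ [])) ∷
  (3 , 10 , (3 ∷ 4 ∷ []) , (2 ∷ 2 ∷ 3 ∷ 1 ∷ 1 ∷ 2 ∷ 4 ∷ 4 ∷ 1 ∷ [])) ∷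
  (3 , 11 , (1 ∷ 4 ∷ []) , (2 ∷ 2 ∷ 3 ∷ 1 ∷ 1 ∷ 2 ∷ 4 ∷ 4 ∷ 3 ∷ 3 ∷ [])) ∷
  (4 , 4 , (4 ∷ 1 ∷ 3 ∷ []) , (2 ∷ 2 ∷ 1 ∷ [])) ∷
  (4 , 5 , (1 ∷ 4 ∷ 4 ∷ []) , (2 ∷ 2 ∷ 1 ∷ 3 ∷ [])) ∷
  (4 , 6 , (3 ∷ 4 ∷ 4 ∷ []) , (2 ∷ 2 ∷ 3 ∷ 1 ∷ 1 ∷ [])) ∷
  (4 , 7 , (4 ∷ 1 ∷ 2 ∷ []) , (3 ∷ 4 ∷ 4 ∷ 2 ∷ 3 ∷ 1 ∷ [])) ∷
  (4 , 8 , (3 ∷ 4 ∷ 1 ∷ []) , (2 ∷ 2 ∷ 3 ∷ 1 ∷ 1 ∷ 2 ∷ 4 ∷ [])) ∷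
  (4 , 9 , (3 ∷ 4 ∷ 1 ∷ []) , (2 ∷ 2 ∷ 3 ∷ 1 ∷ 1 ∷ 2 ∷ 4 ∷ 4 ∷ [])) ∷
  (4 , 10 , (3 ∷ 3 ∷ 4 ∷ []) , (2 ∷ 2 ∷ 3 ∷ 1 ∷ 1 ∷ 2 ∷ 4 ∷ 4 ∷ 1 ∷ [])) ∷
  (5 , 5 , (1 ∷ 1 ∷ 4 ∷ 4 ∷ []) , (2 ∷ 2 ∷ 1 ∷ 3 ∷ [])) ∷
  (5 , 6 , (1 ∷ 4 ∷ 2 ∷ 3 ∷ []) , (2 ∷ 2 ∷ 1 ∷ 3 ∷ 4 ∷ [])) ∷
  (5 , 7 , (3 ∷ 4 ∷ 2 ∷ 1 ∷ []) , (2 ∷ 2 ∷ 3 ∷ 1 ∷ 1 ∷ 4 ∷ [])) ∷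
  (5 , 8 , (3 ∷ 3 ∷ 4 ∷ 1 ∷ []) , (2 ∷ 2 ∷ 3 ∷ 1 ∷ 1 ∷ 2 ∷ 4 ∷ [])) ∷
  (5 , 9 , (3 ∷ 3 ∷ 4 ∷ 1 ∷ []) , (2 ∷ 2 ∷ 3 ∷ 1 ∷ 1 ∷ 2 ∷ 4 ∷ 4 ∷ [])) ∷
  (6 , 6 , (1 ∷ 4 ∷ 4 ∷ 2 ∷ 3 ∷ []) , (2 ∷ 2 ∷ 1 ∷ 3 ∷ 4 ∷ [])) ∷
  (6 , 7 , (3 ∷ 4 ∷ 4 ∷ 2 ∷ 1 ∷ []) , (2 ∷ 2 ∷ 3 ∷ 1 ∷ 1 ∷ 4 ∷ [])) ∷
  (6 , 8 , (3 ∷ 3 ∷ 4 ∷ 4 ∷ 1 ∷ []) , (2 ∷ 2 ∷ 3 ∷ 1 ∷ 1 ∷ 2 ∷ 4 ∷ [])) ∷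
  (7 , 7 , (3 ∷ 3 ∷ 4 ∷ 4 ∷ 2 ∷ 1 ∷ []) , (2 ∷ 2 ∷ 3 ∷ 1 ∷ 1 ∷ 4 ∷ [])) ∷
  []

table₇ : Table
table₇ =
  (3 , 3 , (2 ∷ 6 ∷ []) , (4 ∷ 1 ∷ [])) ∷
  (3 , 4 , (1 ∷ 5 ∷ []) , (4 ∷ 1 ∷ 6 ∷ [])) ∷
  (3 , 5 , (5 ∷ 1 ∷ []) , (4 ∷ 1 ∷ 6 ∷ 2 ∷ [])) ∷
  (3 , 6 , (6 ∷ 3 ∷ []) , (4 ∷ 1 ∷ 6 ∷ 2 ∷ 1 ∷ [])) ∷
  (3 , 7 , (3 ∷ 2 ∷ []) , (4 ∷ 1 ∷ 6 ∷ 2 ∷ 1 ∷ 5 ∷ [])) ∷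
  (3 , 8 , (5 ∷ 3 ∷ []) , (4 ∷ 1 ∷ 6 ∷ 2 ∷ 1 ∷ 5 ∷ 6 ∷ [])) ∷
  (3 , 9 , (5 ∷ 2 ∷ []) , (4 ∷ 1 ∷ 6 ∷ 2 ∷ 1 ∷ 0 ∷ 6 ∷ 3 ∷ [])) ∷
  (3 , 10 , (5 ∷ 2 ∷ []) , (4 ∷ 1 ∷ 6 ∷ 2 ∷ 1 ∷ 0 ∷ 6 ∷ 4 ∷ 3 ∷ [])) ∷
  (3 , 11 , (3 ∷ 5 ∷ []) , (4 ∷ 1 ∷ 6 ∷ 2 ∷ 1 ∷ 0 ∷ 6 ∷ 4 ∷ 4 ∷ 2 ∷ [])) ∷
  (3 , 12 , (3 ∷ 2 ∷ []) , (4 ∷ 1 ∷ 6 ∷ 2 ∷ 1 ∷ 0 ∷ 6 ∷ 4 ∷ 4 ∷ 2 ∷ 5 ∷ [])) ∷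
  (3 , 13 , (2 ∷ 1 ∷ []) , (3 ∷ 1 ∷ 1 ∷ 6 ∷ 3 ∷ 4 ∷ 5 ∷ 6 ∷ 6 ∷ 4 ∷ 1 ∷ 5 ∷ [])) ∷
  (3 , 14 , (2 ∷ 1 ∷ []) , (6 ∷ 3 ∷ 5 ∷ 2 ∷ 2 ∷ 3 ∷ 3 ∷ 0 ∷ 5 ∷ 1 ∷ 6 ∷ 2 ∷ 4 ∷ [])) ∷
  (3 , 15 , (2 ∷ 3 ∷ []) , (4 ∷ 1 ∷ 6 ∷ 2 ∷ 1 ∷ 0 ∷ 6 ∷ 4 ∷ 4 ∷ 2 ∷ 5 ∷ 1 ∷ 3 ∷ 5 ∷ [])) ∷
  (3 , 16 , (2 ∷ 3 ∷ []) , (4 ∷ 1 ∷ 6 ∷ 2 ∷ 1 ∷ 0 ∷ 6 ∷ 4 ∷ 4 ∷ 2 ∷ 5 ∷ 1 ∷ 3 ∷ 6 ∷ 5 ∷ [])) ∷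
  (3 , 17 , (2 ∷ 6 ∷ []) , (3 ∷ 1 ∷ 1 ∷ 6 ∷ 3 ∷ 4 ∷ 5 ∷ 6 ∷ 6 ∷ 4 ∷ 0 ∷ 5 ∷ 2 ∷ 2 ∷ 4 ∷ 1 ∷ [])) ∷
  (3 , 18 , (1 ∷ 2 ∷ []) , (6 ∷ 3 ∷ 5 ∷ 2 ∷ 2 ∷ 3 ∷ 3 ∷ 0 ∷ 5 ∷ 1 ∷ 6 ∷ 2 ∷ 4 ∷ 6 ∷ 6 ∷ 5 ∷ 4 ∷ [])) ∷
  (3 , 19 , (1 ∷ 2 ∷ []) , (6 ∷ 3 ∷ 5 ∷ 2 ∷ 2 ∷ 3 ∷ 3 ∷ 0 ∷ 5 ∷ 1 ∷ 6 ∷ 2 ∷ 4 ∷ 6 ∷ 6 ∷ 5 ∷ 5 ∷ 4 ∷ [])) ∷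
  (3 , 20 , (2 ∷ 3 ∷ []) , (4 ∷ 1 ∷ 6 ∷ 2 ∷ 1 ∷ 0 ∷ 6 ∷ 4 ∷ 4 ∷ 2 ∷ 5 ∷ 1 ∷ 3 ∷ 6 ∷ 5 ∷ 3 ∷ 3 ∷ 4 ∷ 5 ∷ [])) ∷
  (3 , 21 , (2 ∷ 3 ∷ []) , (4 ∷ 1 ∷ 6 ∷ 2 ∷ 1 ∷ 0 ∷ 6 ∷ 4 ∷ 4 ∷ 2 ∷ 5 ∷ 1 ∷ 3 ∷ 6 ∷ 5 ∷ 3 ∷ 3 ∷ 4 ∷ 5 ∷ 5 ∷ [])) ∷
  (3 , 22 , (4 ∷ 1 ∷ []) , (6 ∷ 3 ∷ 5 ∷ 2 ∷ 2 ∷ 3 ∷ 3 ∷ 0 ∷ 5 ∷ 1 ∷ 6 ∷ 2 ∷ 4 ∷ 6 ∷ 6 ∷ 5 ∷ 5 ∷ 4 ∷ 3 ∷ 1 ∷ 2 ∷ [])) ∷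
  (3 , 23 , (2 ∷ 1 ∷ []) , (6 ∷ 3 ∷ 5 ∷ 2 ∷ 2 ∷ 3 ∷ 3 ∷ 0 ∷ 5 ∷ 1 ∷ 6 ∷ 2 ∷ 4 ∷ 6 ∷ 6 ∷ 5 ∷ 5 ∷ 4 ∷ 3 ∷ 1 ∷ 4 ∷ 4 ∷ [])) ∷
  (3 , 24 , (2 ∷ 1 ∷ []) , (6 ∷ 3 ∷ 5 ∷ 2 ∷ 2 ∷ 3 ∷ 3 ∷ 0 ∷ 5 ∷ 1 ∷ 6 ∷ 2 ∷ 4 ∷ 6 ∷ 6 ∷ 5 ∷ 5 ∷ 4 ∷ 3 ∷ 1 ∷ 1 ∷ 4 ∷ 4 ∷ [])) ∷
  (4 , 4 , (1 ∷ 5 ∷ 5 ∷ []) , (4 ∷ 1 ∷ 6 ∷ [])) ∷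
  (4 , 5 , (5 ∷ 1 ∷ 1 ∷ []) , (4 ∷ 1 ∷ 6 ∷ 2 ∷ [])) ∷
  (4 , 6 , (6 ∷ 4 ∷ 3 ∷ []) , (4 ∷ 1 ∷ 6 ∷ 2 ∷ 1 ∷ [])) ∷
  (4 , 7 , (3 ∷ 2 ∷ 2 ∷ []) , (4 ∷ 1 ∷ 6 ∷ 2 ∷ 1 ∷ 5 ∷ [])) ∷
  (4 , 8 , (5 ∷ 3 ∷ 3 ∷ []) , (4 ∷ 1 ∷ 6 ∷ 2 ∷ 1 ∷ 5 ∷ 6 ∷ [])) ∷
  (4 , 9 , (5 ∷ 3 ∷ 2 ∷ []) , (4 ∷ 1 ∷ 6 ∷ 2 ∷ 1 ∷ 0 ∷ 6 ∷ 3 ∷ [])) ∷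
  (4 , 10 , (5 ∷ 3 ∷ 2 ∷ []) , (4 ∷ 1 ∷ 6 ∷ 2 ∷ 1 ∷ 0 ∷ 6 ∷ 4 ∷ 3 ∷ [])) ∷
  (4 , 11 , (3 ∷ 3 ∷ 5 ∷ []) , (4 ∷ 1 ∷ 6 ∷ 2 ∷ 1 ∷ 0 ∷ 6 ∷ 4 ∷ 4 ∷ 2 ∷ [])) ∷
  (4 , 12 , (3 ∷ 2 ∷ 2 ∷ []) , (4 ∷ 1 ∷ 6 ∷ 2 ∷ 1 ∷ 0 ∷ 6 ∷ 4 ∷ 4 ∷ 2 ∷ 5 ∷ [])) ∷
  (4 , 13 , (2 ∷ 2 ∷ 1 ∷ []) , (3 ∷ 1 ∷ 1 ∷ 6 ∷ 3 ∷ 4 ∷ 5 ∷ 6 ∷ 6 ∷ 4 ∷ 1 ∷ 5 ∷ [])) ∷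
  (4 , 14 , (5 ∷ 3 ∷ 2 ∷ []) , (4 ∷ 1 ∷ 6 ∷ 2 ∷ 1 ∷ 0 ∷ 6 ∷ 4 ∷ 4 ∷ 2 ∷ 5 ∷ 1 ∷ 3 ∷ [])) ∷
  (4 , 15 , (2 ∷ 2 ∷ 3 ∷ []) , (4 ∷ 1 ∷ 6 ∷ 2 ∷ 1 ∷ 0 ∷ 6 ∷ 4 ∷ 4 ∷ 2 ∷ 5 ∷ 1 ∷ 3 ∷ 5 ∷ [])) ∷
  (4 , 16 , (2 ∷ 2 ∷ 3 ∷ []) , (4 ∷ 1 ∷ 6 ∷ 2 ∷ 1 ∷ 0 ∷ 6 ∷ 4 ∷ 4 ∷ 2 ∷ 5 ∷ 1 ∷ 3 ∷ 6 ∷ 5 ∷ [])) ∷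
  (4 , 17 , (2 ∷ 1 ∷ 1 ∷ []) , (6 ∷ 3 ∷ 5 ∷ 2 ∷ 2 ∷ 3 ∷ 3 ∷ 0 ∷ 5 ∷ 1 ∷ 6 ∷ 2 ∷ 4 ∷ 6 ∷ 5 ∷ 4 ∷ [])) ∷
  (4 , 18 , (5 ∷ 4 ∷ 3 ∷ []) , (4 ∷ 1 ∷ 6 ∷ 2 ∷ 1 ∷ 0 ∷ 6 ∷ 4 ∷ 4 ∷ 2 ∷ 5 ∷ 1 ∷ 3 ∷ 6 ∷ 5 ∷ 3 ∷ 2 ∷ [])) ∷
  (4 , 19 , (3 ∷ 4 ∷ 5 ∷ []) , (4 ∷ 1 ∷ 6 ∷ 2 ∷ 1 ∷ 0 ∷ 6 ∷ 4 ∷ 4 ∷ 2 ∷ 5 ∷ 1 ∷ 3 ∷ 6 ∷ 5 ∷ 3 ∷ 2 ∷ 2 ∷ [])) ∷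
  (4 , 20 , (2 ∷ 2 ∷ 3 ∷ []) , (4 ∷ 1 ∷ 6 ∷ 2 ∷ 1 ∷ 0 ∷ 6 ∷ 4 ∷ 4 ∷ 2 ∷ 5 ∷ 1 ∷ 3 ∷ 6 ∷ 5 ∷ 3 ∷ 3 ∷ 4 ∷ 5 ∷ [])) ∷
  (4 , 21 , (2 ∷ 2 ∷ 3 ∷ []) , (4 ∷ 1 ∷ 6 ∷ 2 ∷ 1 ∷ 0 ∷ 6 ∷ 4 ∷ 4 ∷ 2 ∷ 5 ∷ 1 ∷ 3 ∷ 6 ∷ 5 ∷ 3 ∷ 3 ∷ 4 ∷ 5 ∷ 5 ∷ [])) ∷
  (4 , 22 , (4 ∷ 4 ∷ 1 ∷ []) , (6 ∷ 3 ∷ 5 ∷ 2 ∷ 2 ∷ 3 ∷ 3 ∷ 0 ∷ 5 ∷ 1 ∷ 6 ∷ 2 ∷ 4 ∷ 6 ∷ 6 ∷ 5 ∷ 5 ∷ 4 ∷ 3 ∷ 1 ∷ 2 ∷ [])) ∷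
  (4 , 23 , (2 ∷ 1 ∷ 1 ∷ []) , (6 ∷ 3 ∷ 5 ∷ 2 ∷ 2 ∷ 3 ∷ 3 ∷ 0 ∷ 5 ∷ 1 ∷ 6 ∷ 2 ∷ 4 ∷ 6 ∷ 6 ∷ 5 ∷ 5 ∷ 4 ∷ 3 ∷ 1 ∷ 4 ∷ 4 ∷ [])) ∷
  (5 , 5 , (5 ∷ 1 ∷ 1 ∷ 3 ∷ []) , (4 ∷ 1 ∷ 6 ∷ 2 ∷ [])) ∷
  (5 , 6 , (6 ∷ 4 ∷ 4 ∷ 2 ∷ []) , (4 ∷ 1 ∷ 6 ∷ 2 ∷ 1 ∷ [])) ∷
  (5 , 7 , (3 ∷ 2 ∷ 4 ∷ 6 ∷ []) , (4 ∷ 1 ∷ 6 ∷ 2 ∷ 1 ∷ 5 ∷ [])) ∷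
  (5 , 8 , (5 ∷ 3 ∷ 3 ∷ 1 ∷ []) , (4 ∷ 1 ∷ 6 ∷ 2 ∷ 1 ∷ 5 ∷ 6 ∷ [])) ∷
  (5 , 9 , (5 ∷ 3 ∷ 2 ∷ 2 ∷ []) , (4 ∷ 1 ∷ 6 ∷ 2 ∷ 1 ∷ 0 ∷ 6 ∷ 3 ∷ [])) ∷
  (5 , 10 , (5 ∷ 3 ∷ 2 ∷ 2 ∷ []) , (4 ∷ 1 ∷ 6 ∷ 2 ∷ 1 ∷ 0 ∷ 6 ∷ 4 ∷ 3 ∷ [])) ∷
  (5 , 11 , (3 ∷ 3 ∷ 6 ∷ 5 ∷ []) , (4 ∷ 1 ∷ 6 ∷ 2 ∷ 1 ∷ 0 ∷ 6 ∷ 4 ∷ 4 ∷ 2 ∷ [])) ∷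
  (5 , 12 , (3 ∷ 3 ∷ 2 ∷ 2 ∷ []) , (4 ∷ 1 ∷ 6 ∷ 2 ∷ 1 ∷ 0 ∷ 6 ∷ 4 ∷ 4 ∷ 2 ∷ 5 ∷ [])) ∷
  (5 , 13 , (2 ∷ 3 ∷ 6 ∷ 5 ∷ []) , (4 ∷ 1 ∷ 6 ∷ 2 ∷ 1 ∷ 0 ∷ 6 ∷ 4 ∷ 4 ∷ 2 ∷ 5 ∷ 3 ∷ [])) ∷
  (5 , 14 , (5 ∷ 3 ∷ 2 ∷ 2 ∷ []) , (4 ∷ 1 ∷ 6 ∷ 2 ∷ 1 ∷ 0 ∷ 6 ∷ 4 ∷ 4 ∷ 2 ∷ 5 ∷ 1 ∷ 3 ∷ [])) ∷
  (5 , 15 , (2 ∷ 2 ∷ 3 ∷ 3 ∷ []) , (4 ∷ 1 ∷ 6 ∷ 2 ∷ 1 ∷ 0 ∷ 6 ∷ 4 ∷ 4 ∷ 2 ∷ 5 ∷ 1 ∷ 3 ∷ 5 ∷ [])) ∷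
  (5 , 16 , (2 ∷ 2 ∷ 3 ∷ 3 ∷ []) , (4 ∷ 1 ∷ 6 ∷ 2 ∷ 1 ∷ 0 ∷ 6 ∷ 4 ∷ 4 ∷ 2 ∷ 5 ∷ 1 ∷ 3 ∷ 6 ∷ 5 ∷ [])) ∷
  (5 , 17 , (5 ∷ 4 ∷ 3 ∷ 2 ∷ []) , (4 ∷ 1 ∷ 6 ∷ 2 ∷ 1 ∷ 0 ∷ 6 ∷ 4 ∷ 4 ∷ 2 ∷ 5 ∷ 1 ∷ 3 ∷ 6 ∷ 5 ∷ 3 ∷ [])) ∷
  (5 , 18 , (5 ∷ 4 ∷ 3 ∷ 3 ∷ []) , (4 ∷ 1 ∷ 6 ∷ 2 ∷ 1 ∷ 0 ∷ 6 ∷ 4 ∷ 4 ∷ 2 ∷ 5 ∷ 1 ∷ 3 ∷ 6 ∷ 5 ∷ 3 ∷ 2 ∷ [])) ∷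
  (5 , 19 , (3 ∷ 3 ∷ 4 ∷ 5 ∷ []) , (4 ∷ 1 ∷ 6 ∷ 2 ∷ 1 ∷ 0 ∷ 6 ∷ 4 ∷ 4 ∷ 2 ∷ 5 ∷ 1 ∷ 3 ∷ 6 ∷ 5 ∷ 3 ∷ 2 ∷ 2 ∷ [])) ∷
  (5 , 20 , (2 ∷ 5 ∷ 5 ∷ 4 ∷ []) , (1 ∷ 4 ∷ 3 ∷ 6 ∷ 4 ∷ 2 ∷ 2 ∷ 1 ∷ 1 ∷ 6 ∷ 5 ∷ 3 ∷ 2 ∷ 6 ∷ 6 ∷ 0 ∷ 3 ∷ 1 ∷ 5 ∷ [])) ∷
  (5 , 21 , (2 ∷ 1 ∷ 4 ∷ 4 ∷ []) , (6 ∷ 3 ∷ 5 ∷ 2 ∷ 2 ∷ 3 ∷ 3 ∷ 0 ∷ 5 ∷ 1 ∷ 6 ∷ 2 ∷ 4 ∷ 6 ∷ 6 ∷ 5 ∷ 5 ∷ 4 ∷ 3 ∷ 1 ∷ [])) ∷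
  (5 , 22 , (4 ∷ 4 ∷ 1 ∷ 1 ∷ []) , (6 ∷ 3 ∷ 5 ∷ 2 ∷ 2 ∷ 3 ∷ 3 ∷ 0 ∷ 5 ∷ 1 ∷ 6 ∷ 2 ∷ 4 ∷ 6 ∷ 6 ∷ 5 ∷ 5 ∷ 4 ∷ 3 ∷ 1 ∷ 2 ∷ [])) ∷
  (6 , 6 , (6 ∷ 4 ∷ 4 ∷ 2 ∷ 5 ∷ []) , (4 ∷ 1 ∷ 6 ∷ 2 ∷ 1 ∷ [])) ∷
  (6 , 7 , (3 ∷ 2 ∷ 4 ∷ 6 ∷ 6 ∷ []) , (4 ∷ 1 ∷ 6 ∷ 2 ∷ 1 ∷ 5 ∷ [])) ∷
  (6 , 8 , (5 ∷ 3 ∷ 3 ∷ 1 ∷ 1 ∷ []) , (4 ∷ 1 ∷ 6 ∷ 2 ∷ 1 ∷ 5 ∷ 6 ∷ [])) ∷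
  (6 , 9 , (5 ∷ 3 ∷ 1 ∷ 5 ∷ 2 ∷ []) , (4 ∷ 1 ∷ 6 ∷ 2 ∷ 1 ∷ 0 ∷ 6 ∷ 3 ∷ [])) ∷
  (6 , 10 , (5 ∷ 3 ∷ 6 ∷ 5 ∷ 2 ∷ []) , (4 ∷ 1 ∷ 6 ∷ 2 ∷ 1 ∷ 0 ∷ 6 ∷ 4 ∷ 3 ∷ [])) ∷
  (6 , 11 , (3 ∷ 3 ∷ 6 ∷ 5 ∷ 5 ∷ []) , (4 ∷ 1 ∷ 6 ∷ 2 ∷ 1 ∷ 0 ∷ 6 ∷ 4 ∷ 4 ∷ 2 ∷ [])) ∷
  (6 , 12 , (3 ∷ 6 ∷ 5 ∷ 3 ∷ 2 ∷ []) , (4 ∷ 1 ∷ 6 ∷ 2 ∷ 1 ∷ 0 ∷ 6 ∷ 4 ∷ 4 ∷ 2 ∷ 5 ∷ [])) ∷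
  (6 , 13 , (2 ∷ 2 ∷ 3 ∷ 4 ∷ 5 ∷ []) , (4 ∷ 1 ∷ 6 ∷ 2 ∷ 1 ∷ 0 ∷ 6 ∷ 4 ∷ 4 ∷ 2 ∷ 5 ∷ 3 ∷ [])) ∷
  (6 , 14 , (5 ∷ 3 ∷ 3 ∷ 2 ∷ 2 ∷ []) , (4 ∷ 1 ∷ 6 ∷ 2 ∷ 1 ∷ 0 ∷ 6 ∷ 4 ∷ 4 ∷ 2 ∷ 5 ∷ 1 ∷ 3 ∷ [])) ∷
  (6 , 15 , (1 ∷ 5 ∷ 3 ∷ 2 ∷ 6 ∷ []) , (3 ∷ 1 ∷ 1 ∷ 6 ∷ 3 ∷ 4 ∷ 5 ∷ 6 ∷ 6 ∷ 4 ∷ 0 ∷ 5 ∷ 2 ∷ 2 ∷ [])) ∷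
  (6 , 16 , (2 ∷ 3 ∷ 4 ∷ 5 ∷ 3 ∷ []) , (4 ∷ 1 ∷ 6 ∷ 2 ∷ 1 ∷ 0 ∷ 6 ∷ 4 ∷ 4 ∷ 2 ∷ 5 ∷ 1 ∷ 3 ∷ 6 ∷ 5 ∷ [])) ∷
  (6 , 17 , (5 ∷ 4 ∷ 3 ∷ 3 ∷ 2 ∷ []) , (4 ∷ 1 ∷ 6 ∷ 2 ∷ 1 ∷ 0 ∷ 6 ∷ 4 ∷ 4 ∷ 2 ∷ 5 ∷ 1 ∷ 3 ∷ 6 ∷ 5 ∷ 3 ∷ [])) ∷
  (6 , 18 , (5 ∷ 5 ∷ 4 ∷ 3 ∷ 3 ∷ []) , (4 ∷ 1 ∷ 6 ∷ 2 ∷ 1 ∷ 0 ∷ 6 ∷ 4 ∷ 4 ∷ 2 ∷ 5 ∷ 1 ∷ 3 ∷ 6 ∷ 5 ∷ 3 ∷ 2 ∷ [])) ∷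
  (6 , 19 , (3 ∷ 3 ∷ 4 ∷ 5 ∷ 5 ∷ []) , (4 ∷ 1 ∷ 6 ∷ 2 ∷ 1 ∷ 0 ∷ 6 ∷ 4 ∷ 4 ∷ 2 ∷ 5 ∷ 1 ∷ 3 ∷ 6 ∷ 5 ∷ 3 ∷ 2 ∷ 2 ∷ [])) ∷
  (6 , 20 , (2 ∷ 1 ∷ 4 ∷ 3 ∷ 1 ∷ []) , (6 ∷ 3 ∷ 5 ∷ 2 ∷ 2 ∷ 3 ∷ 3 ∷ 0 ∷ 5 ∷ 1 ∷ 6 ∷ 2 ∷ 4 ∷ 6 ∷ 6 ∷ 5 ∷ 5 ∷ 4 ∷ 4 ∷ [])) ∷
  (6 , 21 , (2 ∷ 1 ∷ 1 ∷ 4 ∷ 4 ∷ []) , (6 ∷ 3 ∷ 5 ∷ 2 ∷ 2 ∷ 3 ∷ 3 ∷ 0 ∷ 5 ∷ 1 ∷ 6 ∷ 2 ∷ 4 ∷ 6 ∷ 6 ∷ 5 ∷ 5 ∷ 4 ∷ 3 ∷ 1 ∷ [])) ∷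
  (7 , 7 , (3 ∷ 2 ∷ 4 ∷ 6 ∷ 3 ∷ 1 ∷ []) , (4 ∷ 1 ∷ 6 ∷ 2 ∷ 1 ∷ 5 ∷ [])) ∷
  (7 , 8 , (5 ∷ 3 ∷ 3 ∷ 6 ∷ 4 ∷ 2 ∷ []) , (4 ∷ 1 ∷ 6 ∷ 2 ∷ 1 ∷ 5 ∷ 6 ∷ [])) ∷
  (7 , 9 , (5 ∷ 3 ∷ 1 ∷ 5 ∷ 2 ∷ 2 ∷ []) , (4 ∷ 1 ∷ 6 ∷ 2 ∷ 1 ∷ 0 ∷ 6 ∷ 3 ∷ [])) ∷
  (7 , 10 , (5 ∷ 3 ∷ 6 ∷ 5 ∷ 2 ∷ 2 ∷ []) , (4 ∷ 1 ∷ 6 ∷ 2 ∷ 1 ∷ 0 ∷ 6 ∷ 4 ∷ 3 ∷ [])) ∷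
  (7 , 11 , (3 ∷ 3 ∷ 6 ∷ 6 ∷ 5 ∷ 5 ∷ []) , (4 ∷ 1 ∷ 6 ∷ 2 ∷ 1 ∷ 0 ∷ 6 ∷ 4 ∷ 4 ∷ 2 ∷ [])) ∷
  (7 , 12 , (3 ∷ 6 ∷ 5 ∷ 3 ∷ 2 ∷ 2 ∷ []) , (4 ∷ 1 ∷ 6 ∷ 2 ∷ 1 ∷ 0 ∷ 6 ∷ 4 ∷ 4 ∷ 2 ∷ 5 ∷ [])) ∷
  (7 , 13 , (2 ∷ 2 ∷ 3 ∷ 4 ∷ 5 ∷ 5 ∷ []) , (4 ∷ 1 ∷ 6 ∷ 2 ∷ 1 ∷ 0 ∷ 6 ∷ 4 ∷ 4 ∷ 2 ∷ 5 ∷ 3 ∷ [])) ∷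
  (7 , 14 , (5 ∷ 6 ∷ 3 ∷ 3 ∷ 2 ∷ 2 ∷ []) , (4 ∷ 1 ∷ 6 ∷ 2 ∷ 1 ∷ 0 ∷ 6 ∷ 4 ∷ 4 ∷ 2 ∷ 5 ∷ 1 ∷ 3 ∷ [])) ∷
  (7 , 15 , (2 ∷ 3 ∷ 6 ∷ 5 ∷ 4 ∷ 3 ∷ []) , (4 ∷ 1 ∷ 6 ∷ 2 ∷ 1 ∷ 0 ∷ 6 ∷ 4 ∷ 4 ∷ 2 ∷ 5 ∷ 1 ∷ 3 ∷ 5 ∷ [])) ∷
  (7 , 16 , (2 ∷ 2 ∷ 3 ∷ 5 ∷ 4 ∷ 3 ∷ []) , (4 ∷ 1 ∷ 6 ∷ 2 ∷ 1 ∷ 0 ∷ 6 ∷ 4 ∷ 4 ∷ 2 ∷ 5 ∷ 1 ∷ 3 ∷ 6 ∷ 5 ∷ [])) ∷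
  (7 , 17 , (5 ∷ 4 ∷ 3 ∷ 3 ∷ 2 ∷ 2 ∷ []) , (4 ∷ 1 ∷ 6 ∷ 2 ∷ 1 ∷ 0 ∷ 6 ∷ 4 ∷ 4 ∷ 2 ∷ 5 ∷ 1 ∷ 3 ∷ 6 ∷ 5 ∷ 3 ∷ [])) ∷
  (7 , 18 , (6 ∷ 2 ∷ 3 ∷ 5 ∷ 5 ∷ 1 ∷ []) , (3 ∷ 1 ∷ 1 ∷ 6 ∷ 3 ∷ 4 ∷ 5 ∷ 6 ∷ 6 ∷ 4 ∷ 0 ∷ 5 ∷ 2 ∷ 2 ∷ 1 ∷ 4 ∷ 2 ∷ [])) ∷
  (7 , 19 , (1 ∷ 4 ∷ 4 ∷ 3 ∷ 1 ∷ 2 ∷ []) , (6 ∷ 3 ∷ 5 ∷ 2 ∷ 2 ∷ 3 ∷ 3 ∷ 0 ∷ 5 ∷ 1 ∷ 6 ∷ 2 ∷ 4 ∷ 6 ∷ 6 ∷ 5 ∷ 5 ∷ 4 ∷ [])) ∷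
  (7 , 20 , (2 ∷ 1 ∷ 4 ∷ 3 ∷ 1 ∷ 1 ∷ []) , (6 ∷ 3 ∷ 5 ∷ 2 ∷ 2 ∷ 3 ∷ 3 ∷ 0 ∷ 5 ∷ 1 ∷ 6 ∷ 2 ∷ 4 ∷ 6 ∷ 6 ∷ 5 ∷ 5 ∷ 4 ∷ 4 ∷ [])) ∷
  (8 , 8 , (5 ∷ 3 ∷ 3 ∷ 1 ∷ 0 ∷ 2 ∷ 3 ∷ []) , (4 ∷ 1 ∷ 6 ∷ 2 ∷ 1 ∷ 5 ∷ 6 ∷ [])) ∷
  (8 , 9 , (5 ∷ 3 ∷ 1 ∷ 5 ∷ 6 ∷ 4 ∷ 2 ∷ []) , (4 ∷ 1 ∷ 6 ∷ 2 ∷ 1 ∷ 0 ∷ 6 ∷ 3 ∷ [])) ∷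
  (8 , 10 , (5 ∷ 3 ∷ 6 ∷ 5 ∷ 4 ∷ 4 ∷ 2 ∷ []) , (4 ∷ 1 ∷ 6 ∷ 2 ∷ 1 ∷ 0 ∷ 6 ∷ 4 ∷ 3 ∷ [])) ∷
  (8 , 11 , (3 ∷ 3 ∷ 6 ∷ 5 ∷ 3 ∷ 1 ∷ 5 ∷ []) , (4 ∷ 1 ∷ 6 ∷ 2 ∷ 1 ∷ 0 ∷ 6 ∷ 4 ∷ 4 ∷ 2 ∷ [])) ∷
  (8 , 12 , (3 ∷ 6 ∷ 5 ∷ 3 ∷ 3 ∷ 2 ∷ 2 ∷ []) , (4 ∷ 1 ∷ 6 ∷ 2 ∷ 1 ∷ 0 ∷ 6 ∷ 4 ∷ 4 ∷ 2 ∷ 5 ∷ [])) ∷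
  (8 , 13 , (2 ∷ 2 ∷ 3 ∷ 1 ∷ 1 ∷ 5 ∷ 5 ∷ []) , (4 ∷ 1 ∷ 6 ∷ 2 ∷ 1 ∷ 0 ∷ 6 ∷ 4 ∷ 4 ∷ 2 ∷ 5 ∷ 3 ∷ [])) ∷
  (8 , 14 , (5 ∷ 3 ∷ 6 ∷ 5 ∷ 4 ∷ 3 ∷ 2 ∷ []) , (4 ∷ 1 ∷ 6 ∷ 2 ∷ 1 ∷ 0 ∷ 6 ∷ 4 ∷ 4 ∷ 2 ∷ 5 ∷ 1 ∷ 3 ∷ [])) ∷
  (8 , 15 , (2 ∷ 2 ∷ 3 ∷ 6 ∷ 5 ∷ 4 ∷ 3 ∷ []) , (4 ∷ 1 ∷ 6 ∷ 2 ∷ 1 ∷ 0 ∷ 6 ∷ 4 ∷ 4 ∷ 2 ∷ 5 ∷ 1 ∷ 3 ∷ 5 ∷ [])) ∷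
  (8 , 16 , (2 ∷ 2 ∷ 3 ∷ 5 ∷ 4 ∷ 3 ∷ 3 ∷ []) , (4 ∷ 1 ∷ 6 ∷ 2 ∷ 1 ∷ 0 ∷ 6 ∷ 4 ∷ 4 ∷ 2 ∷ 5 ∷ 1 ∷ 3 ∷ 6 ∷ 5 ∷ [])) ∷
  (8 , 17 , (5 ∷ 5 ∷ 4 ∷ 3 ∷ 3 ∷ 2 ∷ 2 ∷ []) , (4 ∷ 1 ∷ 6 ∷ 2 ∷ 1 ∷ 0 ∷ 6 ∷ 4 ∷ 4 ∷ 2 ∷ 5 ∷ 1 ∷ 3 ∷ 6 ∷ 5 ∷ 3 ∷ [])) ∷
  (8 , 18 , (6 ∷ 2 ∷ 3 ∷ 3 ∷ 5 ∷ 5 ∷ 1 ∷ []) , (3 ∷ 1 ∷ 1 ∷ 6 ∷ 3 ∷ 4 ∷ 5 ∷ 6 ∷ 6 ∷ 4 ∷ 0 ∷ 5 ∷ 2 ∷ 2 ∷ 1 ∷ 4 ∷ 2 ∷ [])) ∷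
  (8 , 19 , (1 ∷ 4 ∷ 4 ∷ 3 ∷ 1 ∷ 1 ∷ 2 ∷ []) , (6 ∷ 3 ∷ 5 ∷ 2 ∷ 2 ∷ 3 ∷ 3 ∷ 0 ∷ 5 ∷ 1 ∷ 6 ∷ 2 ∷ 4 ∷ 6 ∷ 6 ∷ 5 ∷ 5 ∷ 4 ∷ [])) ∷
  (9 , 9 , (5 ∷ 3 ∷ 1 ∷ 5 ∷ 2 ∷ 3 ∷ 4 ∷ 2 ∷ []) , (4 ∷ 1 ∷ 6 ∷ 2 ∷ 1 ∷ 0 ∷ 6 ∷ 3 ∷ [])) ∷
  (9 , 10 , (5 ∷ 3 ∷ 6 ∷ 5 ∷ 4 ∷ 4 ∷ 2 ∷ 2 ∷ []) , (4 ∷ 1 ∷ 6 ∷ 2 ∷ 1 ∷ 0 ∷ 6 ∷ 4 ∷ 3 ∷ [])) ∷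
  (9 , 11 , (3 ∷ 3 ∷ 6 ∷ 5 ∷ 3 ∷ 1 ∷ 5 ∷ 5 ∷ []) , (4 ∷ 1 ∷ 6 ∷ 2 ∷ 1 ∷ 0 ∷ 6 ∷ 4 ∷ 4 ∷ 2 ∷ [])) ∷
  (9 , 12 , (3 ∷ 6 ∷ 5 ∷ 4 ∷ 3 ∷ 3 ∷ 2 ∷ 2 ∷ []) , (4 ∷ 1 ∷ 6 ∷ 2 ∷ 1 ∷ 0 ∷ 6 ∷ 4 ∷ 4 ∷ 2 ∷ 5 ∷ [])) ∷
  (9 , 13 , (2 ∷ 2 ∷ 3 ∷ 3 ∷ 6 ∷ 6 ∷ 5 ∷ 5 ∷ []) , (4 ∷ 1 ∷ 6 ∷ 2 ∷ 1 ∷ 0 ∷ 6 ∷ 4 ∷ 4 ∷ 2 ∷ 5 ∷ 3 ∷ [])) ∷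
  (9 , 14 , (5 ∷ 3 ∷ 6 ∷ 5 ∷ 4 ∷ 3 ∷ 3 ∷ 2 ∷ []) , (4 ∷ 1 ∷ 6 ∷ 2 ∷ 1 ∷ 0 ∷ 6 ∷ 4 ∷ 4 ∷ 2 ∷ 5 ∷ 1 ∷ 3 ∷ [])) ∷
  (9 , 15 , (2 ∷ 2 ∷ 3 ∷ 6 ∷ 6 ∷ 5 ∷ 4 ∷ 3 ∷ []) , (4 ∷ 1 ∷ 6 ∷ 2 ∷ 1 ∷ 0 ∷ 6 ∷ 4 ∷ 4 ∷ 2 ∷ 5 ∷ 1 ∷ 3 ∷ 5 ∷ [])) ∷
  (9 , 16 , (2 ∷ 2 ∷ 3 ∷ 5 ∷ 5 ∷ 4 ∷ 3 ∷ 3 ∷ []) , (4 ∷ 1 ∷ 6 ∷ 2 ∷ 1 ∷ 0 ∷ 6 ∷ 4 ∷ 4 ∷ 2 ∷ 5 ∷ 1 ∷ 3 ∷ 6 ∷ 5 ∷ [])) ∷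
  (9 , 17 , (2 ∷ 3 ∷ 3 ∷ 5 ∷ 5 ∷ 1 ∷ 2 ∷ 6 ∷ []) , (3 ∷ 1 ∷ 1 ∷ 6 ∷ 3 ∷ 4 ∷ 5 ∷ 6 ∷ 6 ∷ 4 ∷ 0 ∷ 5 ∷ 2 ∷ 2 ∷ 4 ∷ 1 ∷ [])) ∷
  (9 , 18 , (2 ∷ 6 ∷ 6 ∷ 4 ∷ 3 ∷ 3 ∷ 5 ∷ 6 ∷ []) , (1 ∷ 1 ∷ 6 ∷ 3 ∷ 2 ∷ 2 ∷ 1 ∷ 4 ∷ 4 ∷ 2 ∷ 5 ∷ 5 ∷ 1 ∷ 3 ∷ 0 ∷ 5 ∷ 4 ∷ [])) ∷
  (10 , 10 , (5 ∷ 3 ∷ 6 ∷ 5 ∷ 1 ∷ 3 ∷ 3 ∷ 2 ∷ 2 ∷ []) , (4 ∷ 1 ∷ 6 ∷ 2 ∷ 1 ∷ 0 ∷ 6 ∷ 4 ∷ 3 ∷ [])) ∷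
  (10 , 11 , (3 ∷ 3 ∷ 6 ∷ 5 ∷ 3 ∷ 1 ∷ 1 ∷ 5 ∷ 5 ∷ []) , (4 ∷ 1 ∷ 6 ∷ 2 ∷ 1 ∷ 0 ∷ 6 ∷ 4 ∷ 4 ∷ 2 ∷ [])) ∷
  (10 , 12 , (3 ∷ 6 ∷ 5 ∷ 3 ∷ 1 ∷ 5 ∷ 4 ∷ 3 ∷ 2 ∷ []) , (4 ∷ 1 ∷ 6 ∷ 2 ∷ 1 ∷ 0 ∷ 6 ∷ 4 ∷ 4 ∷ 2 ∷ 5 ∷ [])) ∷
  (10 , 13 , (2 ∷ 2 ∷ 3 ∷ 4 ∷ 5 ∷ 6 ∷ 3 ∷ 1 ∷ 5 ∷ []) , (4 ∷ 1 ∷ 6 ∷ 2 ∷ 1 ∷ 0 ∷ 6 ∷ 4 ∷ 4 ∷ 2 ∷ 5 ∷ 3 ∷ [])) ∷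
  (10 , 14 , (5 ∷ 3 ∷ 6 ∷ 5 ∷ 4 ∷ 3 ∷ 3 ∷ 2 ∷ 2 ∷ []) , (4 ∷ 1 ∷ 6 ∷ 2 ∷ 1 ∷ 0 ∷ 6 ∷ 4 ∷ 4 ∷ 2 ∷ 5 ∷ 1 ∷ 3 ∷ [])) ∷
  (10 , 15 , (2 ∷ 2 ∷ 3 ∷ 6 ∷ 6 ∷ 5 ∷ 4 ∷ 3 ∷ 3 ∷ []) , (4 ∷ 1 ∷ 6 ∷ 2 ∷ 1 ∷ 0 ∷ 6 ∷ 4 ∷ 4 ∷ 2 ∷ 5 ∷ 1 ∷ 3 ∷ 5 ∷ [])) ∷
  (10 , 16 , (2 ∷ 1 ∷ 4 ∷ 4 ∷ 2 ∷ 3 ∷ 3 ∷ 5 ∷ 1 ∷ []) , (3 ∷ 1 ∷ 1 ∷ 6 ∷ 3 ∷ 4 ∷ 5 ∷ 6 ∷ 6 ∷ 4 ∷ 0 ∷ 5 ∷ 2 ∷ 2 ∷ 6 ∷ [])) ∷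
  (10 , 17 , (1 ∷ 1 ∷ 5 ∷ 6 ∷ 2 ∷ 3 ∷ 3 ∷ 5 ∷ 5 ∷ []) , (6 ∷ 6 ∷ 3 ∷ 4 ∷ 6 ∷ 1 ∷ 4 ∷ 0 ∷ 3 ∷ 1 ∷ 2 ∷ 4 ∷ 4 ∷ 5 ∷ 2 ∷ 2 ∷ [])) ∷
  (11 , 11 , (3 ∷ 3 ∷ 6 ∷ 5 ∷ 2 ∷ 2 ∷ 3 ∷ 4 ∷ 5 ∷ 5 ∷ []) , (4 ∷ 1 ∷ 6 ∷ 2 ∷ 1 ∷ 0 ∷ 6 ∷ 4 ∷ 4 ∷ 2 ∷ [])) ∷
  (11 , 12 , (3 ∷ 6 ∷ 5 ∷ 3 ∷ 1 ∷ 5 ∷ 4 ∷ 3 ∷ 3 ∷ 2 ∷ []) , (4 ∷ 1 ∷ 6 ∷ 2 ∷ 1 ∷ 0 ∷ 6 ∷ 4 ∷ 4 ∷ 2 ∷ 5 ∷ [])) ∷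
  (11 , 13 , (2 ∷ 2 ∷ 3 ∷ 4 ∷ 5 ∷ 6 ∷ 6 ∷ 3 ∷ 1 ∷ 5 ∷ []) , (4 ∷ 1 ∷ 6 ∷ 2 ∷ 1 ∷ 0 ∷ 6 ∷ 4 ∷ 4 ∷ 2 ∷ 5 ∷ 3 ∷ [])) ∷
  (11 , 14 , (5 ∷ 3 ∷ 6 ∷ 5 ∷ 5 ∷ 4 ∷ 3 ∷ 3 ∷ 2 ∷ 2 ∷ []) , (4 ∷ 1 ∷ 6 ∷ 2 ∷ 1 ∷ 0 ∷ 6 ∷ 4 ∷ 4 ∷ 2 ∷ 5 ∷ 1 ∷ 3 ∷ [])) ∷
  (11 , 15 , (2 ∷ 2 ∷ 3 ∷ 6 ∷ 6 ∷ 5 ∷ 5 ∷ 4 ∷ 3 ∷ 3 ∷ []) , (4 ∷ 1 ∷ 6 ∷ 2 ∷ 1 ∷ 0 ∷ 6 ∷ 4 ∷ 4 ∷ 2 ∷ 5 ∷ 1 ∷ 3 ∷ 5 ∷ [])) ∷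
  (11 , 16 , (2 ∷ 1 ∷ 4 ∷ 4 ∷ 2 ∷ 3 ∷ 3 ∷ 5 ∷ 5 ∷ 1 ∷ []) , (3 ∷ 1 ∷ 1 ∷ 6 ∷ 3 ∷ 4 ∷ 5 ∷ 6 ∷ 6 ∷ 4 ∷ 0 ∷ 5 ∷ 2 ∷ 2 ∷ 6 ∷ [])) ∷
  (12 , 12 , (3 ∷ 6 ∷ 5 ∷ 3 ∷ 1 ∷ 5 ∷ 4 ∷ 3 ∷ 3 ∷ 2 ∷ 2 ∷ []) , (4 ∷ 1 ∷ 6 ∷ 2 ∷ 1 ∷ 0 ∷ 6 ∷ 4 ∷ 4 ∷ 2 ∷ 5 ∷ [])) ∷
  (12 , 13 , (2 ∷ 2 ∷ 3 ∷ 4 ∷ 5 ∷ 6 ∷ 6 ∷ 3 ∷ 3 ∷ 1 ∷ 5 ∷ []) , (4 ∷ 1 ∷ 6 ∷ 2 ∷ 1 ∷ 0 ∷ 6 ∷ 4 ∷ 4 ∷ 2 ∷ 5 ∷ 3 ∷ [])) ∷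
  (12 , 14 , (5 ∷ 3 ∷ 6 ∷ 6 ∷ 5 ∷ 5 ∷ 4 ∷ 3 ∷ 3 ∷ 2 ∷ 2 ∷ []) , (4 ∷ 1 ∷ 6 ∷ 2 ∷ 1 ∷ 0 ∷ 6 ∷ 4 ∷ 4 ∷ 2 ∷ 5 ∷ 1 ∷ 3 ∷ [])) ∷
  (12 , 15 , (1 ∷ 5 ∷ 5 ∷ 3 ∷ 3 ∷ 2 ∷ 4 ∷ 4 ∷ 1 ∷ 2 ∷ 6 ∷ []) , (3 ∷ 1 ∷ 1 ∷ 6 ∷ 3 ∷ 4 ∷ 5 ∷ 6 ∷ 6 ∷ 4 ∷ 0 ∷ 5 ∷ 2 ∷ 2 ∷ [])) ∷
  (13 , 13 , (2 ∷ 2 ∷ 3 ∷ 4 ∷ 5 ∷ 6 ∷ 6 ∷ 3 ∷ 3 ∷ 1 ∷ 1 ∷ 5 ∷ []) , (4 ∷ 1 ∷ 6 ∷ 2 ∷ 1 ∷ 0 ∷ 6 ∷ 4 ∷ 4 ∷ 2 ∷ 5 ∷ 3 ∷ [])) ∷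
  (13 , 14 , (6 ∷ 2 ∷ 2 ∷ 1 ∷ 4 ∷ 4 ∷ 2 ∷ 3 ∷ 3 ∷ 5 ∷ 5 ∷ 1 ∷ []) , (3 ∷ 1 ∷ 1 ∷ 6 ∷ 3 ∷ 4 ∷ 5 ∷ 6 ∷ 6 ∷ 4 ∷ 0 ∷ 5 ∷ 2 ∷ [])) ∷
  []

allRealisable₅ : AllRealisable 5
allRealisable₅ = covers⇒allRealisable table₅ (from-yes (tableCovers? 5 table₅))

allRealisable₇ : AllRealisable 7
allRealisable₇ = covers⇒allRealisable table₇ (from-yes (tableCovers? 7 table₇))

6<size : ∀ {a b} → 3 ≤ a → a ≤ b → 6 < 1 + a + b
6<size 3≤a a≤b = s≤s (+-mono-≤ 3≤a (≤-trans 3≤a a≤b))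

allRealisable-odd : ∀ t → AllRealisable (1 + 2 * t)
allRealisable-odd 0 a b 3≤a a≤b size≤ = ⊥-elim (<⇒≱ (6<size 3≤a a≤b) (≤-trans size≤ (s≤s z≤n)))
allRealisable-odd 1 a b 3≤a a≤b size≤ = ⊥-elim (<⇒≱ (6<size 3≤a a≤b) size≤)
allRealisable-odd 2 = allRealisable₅
allRealisable-odd 3 = allRealisable₇
allRealisable-odd (suc t@(suc (suc (suc _)))) =
  subst AllRealisable (cong suc (sym (*-suc 2 t)))
        (allRealisable-step t (s≤s (s≤s (s≤s z≤n))) (allRealisable-odd t))

theorem2p5 : (k c₂ c₃ : ℕ) → ∃ (λ t → k ≡ suc (2 * t)) → 1 ≤ c₂ → c₂ ≤ c₃ →
    EmbedsIn (petal1 c₂ c₃) k ⇔ (3 ≤ c₂ × 1 + c₂ + c₃ ≤ (k + 1) C 2)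
theorem2p5 _ c₂ c₃ (t , refl) 1≤c₂ c₂≤c₃ = mk⇔
  (λ embeds → embeds⇒3≤c₂ 1≤c₂ embeds , subst (1 + c₂ + c₃ ≤_) edgeCount (embeds⇒size≤ embeds))
  (λ (3≤c₂ , size≤) → realisable⇒embeds z<s
     (allRealisable-odd t c₂ c₃ 3≤c₂ c₂≤c₃ (subst (1 + c₂ + c₃ ≤_) (sym edgeCount) size≤)))
  where
  edgeCount : triangle (suc (2 * t)) ≡ (suc (2 * t) + 1) C 2
  edgeCount = triangle≡C (suc (2 * t))
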